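{- Let $n=p_1^{\alpha_1}p_2^{\alpha_2}\cdots p_r^{\alpha_r}$ where $r\ge 2$, $p_1<p_2<\cdots<p_r$ are primes and $\alpha_i\in\mathbb{N}$ for $1\le i\le r$. Then in $\mathcal{G}(\mathbb{Z}_n)$: (i) $\deg(\overline{p_1^{\alpha_1}})\ge\deg(\overline{p_r^{\alpha_r}})$; (ii) $\deg(\overline{p_i^{\gamma}})\ge\deg(\overline{p_i^{\beta}})$ for all $1\le i\le r$ and $1\le\gamma<\beta\le\alpha_i$; (iii) $\deg(\overline{p_i^{\beta}})\ge\deg(\overline{p_j^{\beta}})$ for all $1\le i<j\le r$ and $1\le\beta\le\min\{\alpha_i,\alpha_j\}$; (iv) $\deg(\overline{p_1^{\beta_1}p_2^{\beta_2}\cdots p_r^{\beta_r}})\ge\deg(\overline{p_2^{\beta_2}\cdots p_r^{\beta_r}})$ whenever $1\le\beta_i\le\alpha_i$ for all $1\le i\le r$ and $\sum_{i=1}^r\beta_i<\sum_{i=1}^r\alpha_i$.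
   Context: $\mathbb{Z}_n$ is the additive group of integers modulo $n$, and $\overline{a}$ denotes the class of $a$. The power graph $\mathcal{G}(G)$ of a group $G$ has vertex set $G$, distinct $u,v$ adjacent iff one is a positive integer power (multiple) of the other. -}

module Defs where

open import Data.Nat using (ℕ; zero; suc; _+_; _*_; _≤_)
open import Data.Fin using (Fin; toℕ)
import Data.Fin as F
open import Data.Fin.Subset using (Subset; _∈_; ∣_∣)
open import Data.Integer using (ℤ; +_; _-_)
open import Data.Integer.Divisibility using () renaming (_∣_ to _∣ℤ_)
open import Data.Product using (Σ; ∃; ∃-syntax; _×_)
open import Data.Sum using (_⊎_)
open import Relation.Binary.PropositionalEquality using (_≡_; _≢_)

prodF : (r : ℕ) → (Fin r → ℕ) → ℕ
prodF zero f = 1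
prodF (suc r) f = f F.zero * prodF r (λ i → f (F.suc i))

sumF : (r : ℕ) → (Fin r → ℕ) → ℕ
sumF zero f = 0
sumF (suc r) f = f F.zero + sumF r (λ i → f (F.suc i))

_≡_[mod_] : ℕ → ℕ → ℕ → Set
a ≡ b [mod n ] = (+ n) ∣ℤ ((+ a) - (+ b))

-- Z_n is represented by Fin n (canonical representatives 0..n-1).
-- u is a positive integer multiple of v in Z_n
IsMultiple : (n : ℕ) → Fin n → Fin n → Set
IsMultiple n u v = ∃[ k ] (1 ≤ k × toℕ u ≡ k * toℕ v [mod n ])

Adj : (n : ℕ) → Fin n → Fin n → Set
Adj n u v = u ≢ v × (IsMultiple n u v ⊎ IsMultiple n v u)

Deg : (n : ℕ) → Fin n → ℕ → Set
Deg n v d = Σ (Subset n) λ S →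
  ((u : Fin n) → (u ∈ S → Adj n u v) × (Adj n u v → u ∈ S)) × ∣ S ∣ ≡ d

ClassDeg : (n a d : ℕ) → Set
ClassDeg n a d = ∃[ v ] (toℕ v ≡ a [mod n ] × Deg n v d)

DegGe : (n a b : ℕ) → Set
DegGe n a b = (da db : ℕ) → ClassDeg n a da → ClassDeg n b db → db ≤ da

module Submission where

-- Every vertex compared is the class of a divisor A_c = ∏ pᵢ^cᵢ (cᵢ ≤ αᵢ).
-- In G(Z_n), u is a multiple of A_c iff A_c ∣ u, and A_c is a multiple of u
-- iff gcd(u, n) ∣ A_c, i.e. iff for each i either cᵢ = αᵢ or pᵢ^(cᵢ+1) ∤ u.
-- Both conditions depend only on the residues u mod pᵢ^αᵢ, so by the Chinese
-- remainder theorem the two sets and their intersection have sizes that are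
-- products of local counts locP, locL, locE at single prime powers, and
-- inclusion–exclusion gives the degree formula (module Degree)
--     deg(A_c) + 1 + ∏ locE = ∏ locP + ∏ locL.
-- So deg(A_c) ≥ deg(A_c') reduces to an inequality c ≽ c' between products
-- (module Criterion).  The local counts have closed forms (locP = p^(α-c),
-- …; module LocalCounts), and each part of the proposition becomes an
-- explicit inequality between them (modules Inequalities and LocalShapes),
-- assembled in module Comparisons; part (i) with α₀ ≤ α_r is obtained by
-- passing through p_r^α₀ with parts (iii) and (ii).

open import Defs
open import Data.Nat using (ℕ; suc; _+_; _^_; _≤_; _<_)
open import Data.Fin using (Fin; fromℕ)
import Data.Fin as F
open import Data.Nat.Primality using (Prime)
open import Data.Product using (_×_)
open import Relation.Binary.PropositionalEquality using (_≡_; refl)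

module Counting where

  open import Data.Nat
  open import Data.Nat.Properties
  open import Data.Bool using (Bool; true; false; _∧_; _∨_; not; T)
  open import Data.Fin using (Fin; toℕ; fromℕ<; punchOut)
  import Data.Fin.Properties as FP
  open import Data.Fin.Permutation using (Permutation; permutation)
  open import Data.Product using (∃; _,_; proj₁; proj₂)
  open import Data.Empty using (⊥-elim)
  open import Relation.Nullary using (¬_; yes; no)
  open import Relation.Binary.PropositionalEquality
  open import Function.Definitions using (Injective)
  open import Function.Bundles using (Equivalence)
  open import Data.Bool.Properties using (T-∧)
  open import Algebra.Properties.CommutativeSemigroup +-commutativeSemigroup using (interchange)
  import Algebra.Properties.CommutativeMonoid.Sum +-0-commutativeMonoid as Sum

  b2n : Bool → ℕ
  b2n true = 1
  b2n false = 0

  T-ext : ∀ {x y} → (T x → T y) → (T y → T x) → x ≡ y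
  T-ext {true} {true} _ _ = refl
  T-ext {true} {false} f _ = ⊥-elim (f _)
  T-ext {false} {true} _ g = ⊥-elim (g _)
  T-ext {false} {false} _ _ = refl

  T-not⁺ : ∀ {x} → ¬ T x → T (not x)
  T-not⁺ {true} h = h _
  T-not⁺ {false} _ = _

  T-not⁻ : ∀ {x} → T (not x) → ¬ T x
  T-not⁻ {true} () _

  cnt : ℕ → (ℕ → Bool) → ℕ
  cnt zero f = 0
  cnt (suc n) f = b2n (f 0) + cnt n (λ u → f (suc u))

  cnt-ext : ∀ n {f g : ℕ → Bool} → (∀ u → u < n → f u ≡ g u) → cnt n f ≡ cnt n g
  cnt-ext zero h = refl
  cnt-ext (suc n) h = cong₂ _+_ (cong b2n (h 0 z<s)) (cnt-ext n (λ u u<n → h (suc u) (s<s u<n)))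

  cnt-+ : ∀ a b f → cnt (a + b) f ≡ cnt a f + cnt b (λ u → f (a + u))
  cnt-+ zero b f = refl
  cnt-+ (suc a) b f = trans (cong (b2n (f 0) +_) (cnt-+ a b (λ u → f (suc u)))) (sym (+-assoc (b2n (f 0)) _ _))

  cnt-∨ : ∀ n (f g : ℕ → Bool) → cnt n (λ u → f u ∨ g u) + cnt n (λ u → f u ∧ g u) ≡ cnt n f + cnt n g
  cnt-∨ zero f g = refl
  cnt-∨ (suc n) f g = begin
      (b2n (f 0 ∨ g 0) + X) + (b2n (f 0 ∧ g 0) + Y)  ≡⟨ interchange (b2n (f 0 ∨ g 0)) X (b2n (f 0 ∧ g 0)) Y ⟩
      (b2n (f 0 ∨ g 0) + b2n (f 0 ∧ g 0)) + (X + Y)  ≡⟨ cong₂ _+_ (local (f 0) (g 0)) (cnt-∨ n _ _) ⟩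
      (b2n (f 0) + b2n (g 0)) + (cnt n f' + cnt n g') ≡⟨ interchange (b2n (f 0)) (b2n (g 0)) (cnt n f') (cnt n g') ⟩
      (b2n (f 0) + cnt n f') + (b2n (g 0) + cnt n g') ∎
    where
    open ≡-Reasoning
    f' g' : ℕ → Bool
    f' u = f (suc u)
    g' u = g (suc u)
    X Y : ℕ
    X = cnt n (λ u → f' u ∨ g' u)
    Y = cnt n (λ u → f' u ∧ g' u)
    local : ∀ x y → b2n (x ∨ y) + b2n (x ∧ y) ≡ b2n x + b2n y
    local true y = refl
    local false y = +-identityʳ (b2n y)

  cnt-split : ∀ n (g f : ℕ → Bool) → cnt n g ≡ cnt n (λ u → g u ∧ f u) + cnt n (λ u → g u ∧ not (f u))
  cnt-split zero g f = refl
  cnt-split (suc n) g f = begin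
      b2n (g 0) + cnt n g'                                                ≡⟨ cong₂ _+_ (local (g 0) (f 0)) (cnt-split n g' f') ⟩
      (b2n (g 0 ∧ f 0) + b2n (g 0 ∧ not (f 0))) + (X + Y) ≡⟨ interchange (b2n (g 0 ∧ f 0)) (b2n (g 0 ∧ not (f 0))) X Y ⟩
      (b2n (g 0 ∧ f 0) + X) + (b2n (g 0 ∧ not (f 0)) + Y) ∎
    where
    open ≡-Reasoning
    f' g' : ℕ → Bool
    f' u = f (suc u)
    g' u = g (suc u)
    X Y : ℕ
    X = cnt n (λ u → g' u ∧ f' u)
    Y = cnt n (λ u → g' u ∧ not (f' u))
    local : ∀ x y → b2n x ≡ b2n (x ∧ y) + b2n (x ∧ not y)
    local true true = refl
    local true false = refl
    local false y = refl

  cnt-difference : ∀ n (g f : ℕ → Bool) → (∀ u → T (f u) → T (g u)) →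
    cnt n g ≡ cnt n f + cnt n (λ u → g u ∧ not (f u))
  cnt-difference n g f f⊆g = trans (cnt-split n g f) (cong (_+ cnt n (λ u → g u ∧ not (f u))) (cnt-ext n (λ u _ → T-ext
    (λ t → proj₂ (Equivalence.to T-∧ t)) (λ t → Equivalence.from T-∧ (f⊆g u t , t)))))

  cnt-false : ∀ n f → (∀ u → u < n → f u ≡ false) → cnt n f ≡ 0
  cnt-false zero f h = refl
  cnt-false (suc n) f h rewrite h 0 z<s = cnt-false n (λ u → f (suc u)) (λ u u<n → h (suc u) (s<s u<n))

  cnt-true : ∀ n f → (∀ u → u < n → f u ≡ true) → cnt n f ≡ n
  cnt-true zero f h = refl
  cnt-true (suc n) f h rewrite h 0 z<s = cong suc (cnt-true n (λ u → f (suc u)) (λ u u<n → h (suc u) (s<s u<n)))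

  cnt-∧-const : ∀ n b g → cnt n (λ u → b ∧ g u) ≡ b2n b * cnt n g
  cnt-∧-const n true g = sym (+-identityʳ (cnt n g))
  cnt-∧-const n false g = cnt-false n _ (λ _ _ → refl)

  cnt-point : ∀ n k (f : ℕ → Bool) → k < n → cnt n (λ u → f u ∧ (u ≡ᵇ k)) ≡ b2n (f k)
  cnt-point (suc n) zero f _ = trans (cong₂ _+_ (lemma (f 0)) (cnt-false n _ (λ u _ → ∧-false (f (suc u))))) (+-identityʳ _)
    where
    open import Data.Bool.Properties using () renaming (∧-identityʳ to ∧-true; ∧-zeroʳ to ∧-false)
    lemma : ∀ b → b2n (b ∧ true) ≡ b2n b
    lemma b = cong b2n (∧-true b)
  cnt-point (suc n) (suc k) f (s<s k<n) = trans (cong (_+ cnt n (λ u → f (suc u) ∧ (u ≡ᵇ k))) (cong b2n (∧-false (f 0)))) (cnt-point n k (λ u → f (suc u)) k<n)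
    where open import Data.Bool.Properties using () renaming (∧-zeroʳ to ∧-false)

  injective⇒surjective : ∀ n (g : Fin n → Fin n) → Injective _≡_ _≡_ g → ∀ y → ∃ λ x → g x ≡ y
  injective⇒surjective (suc n) g inj y with FP.any? (λ x → g x FP.≟ y)
  ... | yes hit = hit
  ... | no miss = ⊥-elim (<-irrefl refl (FP.injective⇒≤ {f = avoid} avoid-injective))
    where
    avoid : Fin (suc n) → Fin n
    avoid x = punchOut {i = y} (λ e → miss (x , sym e))
    avoid-injective : Injective _≡_ _≡_ avoid
    avoid-injective {x} {x′} e = inj (FP.punchOut-injective (λ e′ → miss (x , sym e′)) (λ e′ → miss (x′ , sym e′)) e)

  cnt-perm : ∀ N (σ : ℕ → ℕ) (f : ℕ → Bool) → (∀ u → u < N → σ u < N) →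
             (∀ u v → u < N → v < N → σ u ≡ σ v → u ≡ v) →
             cnt N (λ u → f (σ u)) ≡ cnt N f
  cnt-perm N σ f bound inj = begin
      cnt N (λ u → f (σ u))                      ≡⟨ asSum N _ ⟩
      Sum.sum {N} (λ i → b2n (f (σ (toℕ i))))       ≡⟨ Sum.sum-cong-≗ {N} (λ i → cong (b2n ∘ f) (sym (FP.toℕ-fromℕ< (bound′ i)))) ⟩
      Sum.sum {N} (λ i → b2n (f (toℕ (σF i))))       ≡⟨ sym (Sum.sum-permute (λ i → b2n (f (toℕ i))) π) ⟩
      Sum.sum {N} (λ i → b2n (f (toℕ i)))       ≡⟨ sym (asSum N f) ⟩
      cnt N f ∎
    where
    open ≡-Reasoning
    open import Function using (_∘_)
    asSum : ∀ n f → cnt n f ≡ Sum.sum (λ (i : Fin n) → b2n (f (toℕ i)))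
    asSum zero f = refl
    asSum (suc n) f = cong (b2n (f 0) +_) (asSum n (λ u → f (suc u)))
    bound′ : (i : Fin N) → σ (toℕ i) < N
    bound′ i = bound (toℕ i) (FP.toℕ<n i)
    σF : Fin N → Fin N
    σF i = fromℕ< (bound′ i)
    σF-injective : Injective _≡_ _≡_ σF
    σF-injective {i} {j} e = FP.toℕ-injective (inj (toℕ i) (toℕ j) (FP.toℕ<n i) (FP.toℕ<n j)
       (trans (sym (FP.toℕ-fromℕ< (bound′ i))) (trans (cong toℕ e) (FP.toℕ-fromℕ< (bound′ j)))))
    onto : ∀ y → ∃ λ x → σF x ≡ y
    onto = injective⇒surjective N σF σF-injective
    π : Permutation N N
    π = permutation σF (λ y → proj₁ (onto y)) (λ y → proj₂ (onto y)) (λ x → σF-injective (proj₂ (onto (σF x))))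

module CRT where

  open import Defs using (prodF)
  open import Data.Nat
  open import Data.Nat.Properties
  open import Data.Nat.DivMod
  open import Data.Nat.Divisibility
  open import Data.Bool using (Bool; true; _∧_)
  open import Data.Fin using (Fin)
  import Data.Fin as F
  open import Data.Product using (_×_; _,_)
  open import Data.Sum using (inj₁; inj₂)
  open import Data.Empty using (⊥-elim)
  open import Data.Unit using (⊤)
  open import Relation.Binary.PropositionalEquality
  open Counting

  cnt-block : ∀ q M .{{_ : NonZero M}} (P Q : ℕ → Bool) →
    cnt (q * M) (λ w → P (w / M) ∧ Q (w % M)) ≡ cnt q P * cnt M Q
  cnt-block zero M P Q = refl
  cnt-block (suc q) M P Q = begin
      cnt (M + q * M) (λ w → P (w / M) ∧ Q (w % M))
        ≡⟨ cnt-+ M (q * M) _ ⟩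
      cnt M (λ w → P (w / M) ∧ Q (w % M)) + cnt (q * M) (λ u → P ((M + u) / M) ∧ Q ((M + u) % M))
        ≡⟨ cong₂ _+_ (cnt-ext M (λ u u<M → cong₂ _∧_ (cong P (m<n⇒m/n≡0 u<M)) (cong Q (m<n⇒m%n≡m u<M))))
                     (cnt-ext (q * M) (λ u _ → cong₂ _∧_ (cong P (quotient-shift u)) (cong Q (remainder-shift u)))) ⟩
      cnt M (λ w → P 0 ∧ Q w) + cnt (q * M) (λ u → P (suc (u / M)) ∧ Q (u % M))
        ≡⟨ cong₂ _+_ (cnt-∧-const M (P 0) Q) (cnt-block q M (λ t → P (suc t)) Q) ⟩
      b2n (P 0) * cnt M Q + cnt q (λ t → P (suc t)) * cnt M Q
        ≡⟨ sym (*-distribʳ-+ (cnt M Q) (b2n (P 0)) _) ⟩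
      cnt (suc q) P * cnt M Q ∎
    where
    open ≡-Reasoning
    quotient-shift : ∀ u → (M + u) / M ≡ suc (u / M)
    quotient-shift u = trans (+-distrib-/-∣ˡ u (∣-refl {M})) (cong (_+ u / M) (n/n≡1 M))
    remainder-shift : ∀ u → (M + u) % M ≡ u % M
    remainder-shift u = trans (cong (_% M) (+-comm M u)) ([m+n]%n≡m%n u M)

  Coprime : ℕ → ℕ → Set
  Coprime q M = ∀ x → q ∣ x → M ∣ x → q * M ∣ x

  %-≡⇒∣∸ : ∀ u v d .{{_ : NonZero d}} → u % d ≡ v % d → d ∣ v ∸ u
  %-≡⇒∣∸ u v d e = divides (v / d ∸ u / d) (begin
      v ∸ u                                         ≡⟨ cong₂ _∸_ (m≡m%n+[m/n]*n v d) (m≡m%n+[m/n]*n u d) ⟩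
      (v % d + (v / d) * d) ∸ (u % d + (u / d) * d) ≡⟨ cong (λ t → (v % d + (v / d) * d) ∸ (t + (u / d) * d)) e ⟩
      (v % d + (v / d) * d) ∸ (v % d + (u / d) * d) ≡⟨ [m+n]∸[m+o]≡n∸o (v % d) _ _ ⟩
      (v / d) * d ∸ (u / d) * d                     ≡⟨ sym (*-distribʳ-∸ d (v / d) (u / d)) ⟩
      (v / d ∸ u / d) * d ∎)
    where open ≡-Reasoning

  ∣∧<⇒≡0 : ∀ {N x} → N ∣ x → x < N → x ≡ 0
  ∣∧<⇒≡0 (divides zero refl) _ = refl
  ∣∧<⇒≡0 {N} (divides (suc k) refl) x<N = ⊥-elim (<⇒≱ x<N (m≤m+n N (k * N)))

  residues-injective-≤ : ∀ q M .{{_ : NonZero q}} .{{_ : NonZero M}} → Coprime q M →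
    ∀ {u v} → u ≤ v → v < q * M → u % q ≡ v % q → u % M ≡ v % M → u ≡ v
  residues-injective-≤ q M cop {u} {v} u≤v v< eq eM = ≤-antisym u≤v (m∸n≡0⇒m≤n diff≡0)
    where
    diff≡0 : v ∸ u ≡ 0
    diff≡0 = ∣∧<⇒≡0 (cop (v ∸ u) (%-≡⇒∣∸ u v q eq) (%-≡⇒∣∸ u v M eM)) (≤-<-trans (m∸n≤m v u) v<)

  residues-injective : ∀ q M .{{_ : NonZero q}} .{{_ : NonZero M}} → Coprime q M →
    ∀ u v → u < q * M → v < q * M → u % q ≡ v % q → u % M ≡ v % M → u ≡ v
  residues-injective q M cop u v u< v< eq eM with ≤-total u v
  ... | inj₁ u≤v = residues-injective-≤ q M cop u≤v v< eq eM
  ... | inj₂ v≤u = sym (residues-injective-≤ q M cop v≤u u< (sym eq) (sym eM))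

  mixed-radix-bound : ∀ u q M .{{_ : NonZero q}} .{{_ : NonZero M}} → (u % q) * M + u % M < q * M
  mixed-radix-bound u q M = begin-strict
      (u % q) * M + u % M <⟨ +-monoʳ-< ((u % q) * M) (m%n<n u M) ⟩
      (u % q) * M + M     ≡⟨ +-comm _ M ⟩
      suc (u % q) * M     ≤⟨ *-monoˡ-≤ M (m%n<n u q) ⟩
      q * M ∎
    where open ≤-Reasoning

  -- Two-factor CRT count, via the bijection u ↦ (u % q)·M + u % M of [0, q·M).
  crt2 : ∀ q M .{{_ : NonZero q}} .{{_ : NonZero M}} → Coprime q M → (P Q : ℕ → Bool) →
    cnt (q * M) (λ u → P (u % q) ∧ Q (u % M)) ≡ cnt q P * cnt M Q
  crt2 q M cop P Q = begin
      cnt (q * M) (λ u → P (u % q) ∧ Q (u % M))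
        ≡⟨ cnt-ext (q * M) (λ u _ → cong₂ _∧_ (cong P (sym (σ/ u))) (cong Q (sym (σ% u)))) ⟩
      cnt (q * M) (λ u → g (σ u)) ≡⟨ cnt-perm (q * M) σ g (λ u _ → mixed-radix-bound u q M) σ-injective ⟩
      cnt (q * M) g               ≡⟨ cnt-block q M P Q ⟩
      cnt q P * cnt M Q ∎
    where
    open ≡-Reasoning
    g : ℕ → Bool
    g w = P (w / M) ∧ Q (w % M)
    σ : ℕ → ℕ
    σ u = (u % q) * M + u % M
    σ/ : ∀ u → σ u / M ≡ u % q
    σ/ u = trans (+-distrib-/-∣ˡ (u % M) (n∣m*n (u % q)))
             (trans (cong₂ _+_ (m*n/n≡m (u % q) M) (m<n⇒m/n≡0 (m%n<n u M))) (+-identityʳ _))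
    σ% : ∀ u → σ u % M ≡ u % M
    σ% u = trans (%-remove-+ˡ (u % M) (n∣m*n (u % q))) (m%n%n≡m%n u M)
    σ-injective : ∀ u v → u < q * M → v < q * M → σ u ≡ σ v → u ≡ v
    σ-injective u v u< v< e = residues-injective q M cop u v u< v<
      (trans (sym (σ/ u)) (trans (cong (_/ M) e) (σ/ v)))
      (trans (sym (σ% u)) (trans (cong (_% M) e) (σ% v)))

  allF : (R : ℕ) → (Fin R → Bool) → Bool
  allF zero b = true
  allF (suc R) b = b F.zero ∧ allF R (λ i → b (F.suc i))

  PairwiseCoprime : (R : ℕ) → (Fin R → ℕ) → Set
  PairwiseCoprime zero q = ⊤
  PairwiseCoprime (suc R) q = Coprime (q F.zero) (prodF R (λ i → q (F.suc i))) × PairwiseCoprime R (λ i → q (F.suc i))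

  prodF-pos : ∀ R (f : Fin R → ℕ) → (∀ i → 1 ≤ f i) → 1 ≤ prodF R f
  prodF-pos zero f h = ≤-refl
  prodF-pos (suc R) f h = *-mono-≤ (h F.zero) (prodF-pos R (λ i → f (F.suc i)) (λ i → h (F.suc i)))

  prodF-factor : ∀ R (f : Fin R → ℕ) i → f i ∣ prodF R f
  prodF-factor (suc R) f F.zero = m∣m*n _
  prodF-factor (suc R) f (F.suc i) = ∣n⇒∣m*n (f F.zero) (prodF-factor R (λ j → f (F.suc j)) i)

  crtN : ∀ R (q : Fin R → ℕ) (q≥1 : ∀ i → 1 ≤ q i) → PairwiseCoprime R q → (P : Fin R → ℕ → Bool) →
    cnt (prodF R q) (λ u → allF R (λ i → P i (_%_ u (q i) {{>-nonZero (q≥1 i)}}))) ≡ prodF R (λ i → cnt (q i) (P i))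
  crtN zero q q≥1 pw P = refl
  crtN (suc R) q q≥1 (cop , pw) P = begin
      cnt (q₀ * M) (λ u → allF (suc R) (λ i → P i (_%_ u (q i) {{>-nonZero (q≥1 i)}})))
        ≡⟨ cnt-ext (q₀ * M) (λ u _ → cong (P F.zero (_%_ u q₀ {{>-nonZero (q≥1 F.zero)}}) ∧_) (allF-ext R (λ i → cong (P (F.suc i)) (reduce i u)))) ⟩
      cnt (q₀ * M) (λ u → P F.zero (_%_ u q₀ {{>-nonZero (q≥1 F.zero)}}) ∧ Q (_%_ u M {{M≠0}}))
        ≡⟨ crt2 q₀ M {{>-nonZero (q≥1 F.zero)}} {{M≠0}} cop (P F.zero) Q ⟩
      cnt q₀ (P F.zero) * cnt M Q
        ≡⟨ cong (cnt q₀ (P F.zero) *_) (crtN R (λ i → q (F.suc i)) (λ i → q≥1 (F.suc i)) pw (λ i → P (F.suc i))) ⟩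
      prodF (suc R) (λ i → cnt (q i) (P i)) ∎
    where
    open ≡-Reasoning
    q₀ M : ℕ
    q₀ = q F.zero
    M = prodF R (λ i → q (F.suc i))
    M≠0 : NonZero M
    M≠0 = >-nonZero (prodF-pos R _ (λ i → q≥1 (F.suc i)))
    Q : ℕ → Bool
    Q v = allF R (λ i → P (F.suc i) (_%_ v (q (F.suc i)) {{>-nonZero (q≥1 (F.suc i))}}))
    -- qᵢ ∣ M, so reducing mod M first does not change the residue mod qᵢ.
    reduce : ∀ i u → _%_ u (q (F.suc i)) {{>-nonZero (q≥1 (F.suc i))}} ≡ _%_ (_%_ u M {{M≠0}}) (q (F.suc i)) {{>-nonZero (q≥1 (F.suc i))}}
    reduce i u = sym (m∣n⇒o%n%m≡o%m (q (F.suc i)) M u {{>-nonZero (q≥1 (F.suc i))}} {{M≠0}} (prodF-factor R (λ j → q (F.suc j)) i))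
    allF-ext : ∀ R {b c : Fin R → Bool} → (∀ i → b i ≡ c i) → allF R b ≡ allF R c
    allF-ext zero h = refl
    allF-ext (suc R) h = cong₂ _∧_ (h F.zero) (allF-ext R (λ i → h (F.suc i)))

module PrimePowers where

  open import Defs using (prodF)
  open import Data.Nat
  open import Data.Nat.Properties
  open import Data.Nat.Divisibility
  open import Data.Nat.Primality
  open import Data.Fin using (Fin)
  import Data.Fin as F
  import Data.Fin.Properties as FP
  open import Data.Product using (_,_)
  open import Data.Sum using (_⊎_; inj₁; inj₂)
  open import Data.Empty using (⊥-elim)
  open import Data.Unit using (tt)
  open import Relation.Nullary using (¬_; yes; no)
  open import Relation.Binary.PropositionalEquality
  open CRT using (Coprime; PairwiseCoprime)
  open import Algebra.Properties.CommutativeSemigroup *-commutativeSemigroup using (x∙yz≈y∙xz; x∙yz≈yx∙z)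

  prime>1 : ∀ {p} → Prime p → 1 < p
  prime>1 {p} pp = nonTrivial⇒n>1 p {{prime⇒nonTrivial pp}}

  pow≥1 : ∀ p e → 1 ≤ p → 1 ≤ p ^ e
  pow≥1 p e p≥1 = m^n>0 p {{>-nonZero p≥1}} e

  pow-∣-pow : ∀ p {x y} → x ≤ y → p ^ x ∣ p ^ y
  pow-∣-pow p {x} {y} x≤y = divides (p ^ (y ∸ x)) (trans (cong (p ^_) (sym (m∸n+n≡m x≤y))) (^-distribˡ-+-* p (y ∸ x) x))

  prime-∣-prime : ∀ {s t} → Prime s → Prime t → s ∣ t → s ≡ t
  prime-∣-prime ps pt s∣t with prime⇒irreducible pt s∣t
  ... | inj₁ refl = ⊥-elim (<-irrefl refl (prime>1 ps))
  ... | inj₂ e = e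

  prime-∣-pow : ∀ {s} b e → Prime s → s ∣ b ^ e → s ∣ b
  prime-∣-pow b zero ps s∣1 = ⊥-elim (<-irrefl (sym (∣1⇒≡1 s∣1)) (prime>1 ps))
  prime-∣-pow b (suc e) ps h with euclidsLemma b (b ^ e) ps h
  ... | inj₁ x = x
  ... | inj₂ y = prime-∣-pow b e ps y

  pow-∣-cancelʳ : ∀ {p k} e d → Prime p → ¬ p ∣ k → p ^ e ∣ d * k → p ^ e ∣ d
  pow-∣-cancelʳ zero d pp p∤k h = 1∣ d
  pow-∣-cancelʳ {p} {k} (suc e) d pp p∤k h with euclidsLemma d k pp (∣-trans (m∣m*n (p ^ e)) h)
  ... | inj₂ p∣k = ⊥-elim (p∤k p∣k)
  ... | inj₁ (divides d' refl) = subst (p * p ^ e ∣_) (*-comm p d') (*-monoʳ-∣ p (pow-∣-cancelʳ e d' pp p∤k h'))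
    where
    instance _ = >-nonZero (<⇒≤ (prime>1 pp))
    h' : p ^ e ∣ d' * k
    h' = *-cancelˡ-∣ p (subst (p * p ^ e ∣_) (trans (cong (_* k) (*-comm d' p)) (*-assoc p d' k)) h)

  pow-coprime : ∀ {p M} e → Prime p → ¬ p ∣ M → Coprime (p ^ e) M
  pow-coprime e pp p∤M x h (divides y refl) = *-monoˡ-∣ _ (pow-∣-cancelʳ e y pp p∤M h)

  lower-exponent : ∀ {p M d} a c → Prime p → c ≤ a → d ∣ p ^ a * M → (c ≡ a ⊎ ¬ p ^ suc c ∣ d) → d ∣ p ^ c * M
  lower-exponent a c pp c≤a h (inj₁ refl) = h
  lower-exponent zero zero pp c≤a h (inj₂ _) = h
  lower-exponent {p} {M} {d} (suc a) c pp c≤a h (inj₂ p^c+1∤d) with m≤n⇒m<n∨m≡n c≤a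
  ... | inj₂ refl = h
  ... | inj₁ (s≤s c≤a') = lower-exponent a c pp c≤a' (lower-by-one h (λ q → p^c+1∤d (∣-trans (pow-∣-pow p (s≤s c≤a')) q))) (inj₂ p^c+1∤d)
    where
    lower-by-one : d ∣ p ^ suc a * M → ¬ p ^ suc a ∣ d → d ∣ p ^ a * M
    lower-by-one (divides k eq) nd with p ∣? k
    ... | no p∤k = ⊥-elim (nd (pow-∣-cancelʳ (suc a) d pp p∤k (divides M (trans (*-comm d k) (trans (sym eq) (*-comm (p ^ suc a) M))))))
    ... | yes (divides k' refl) = divides k' (*-cancelˡ-≡ (p ^ a * M) (k' * d) p {{>-nonZero (<⇒≤ (prime>1 pp))}}
            (trans (sym (*-assoc p (p ^ a) M)) (trans eq (trans (cong (_* d) (*-comm k' p)) (*-assoc p k' d)))))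

  Distinct : ∀ R → (Fin R → ℕ) → Set
  Distinct R p = ∀ i j → p i ≡ p j → i ≡ j

  distinct-tail : ∀ R (p : Fin (suc R) → ℕ) → Distinct (suc R) p → Distinct R (λ i → p (F.suc i))
  distinct-tail R p d i j e = FP.suc-injective (d (F.suc i) (F.suc j) e)

  prime∤prodF : ∀ R {s} (p e : Fin R → ℕ) → Prime s → (∀ j → Prime (p j)) → (∀ j → s ≢ p j) →
    ¬ s ∣ prodF R (λ j → p j ^ e j)
  prime∤prodF zero p e ps pr ne h = <-irrefl (sym (∣1⇒≡1 h)) (prime>1 ps)
  prime∤prodF (suc R) p e ps pr ne h with euclidsLemma _ _ ps h
  ... | inj₁ x = ne F.zero (prime-∣-prime ps (pr F.zero) (prime-∣-pow _ (e F.zero) ps x))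
  ... | inj₂ y = prime∤prodF R (λ j → p (F.suc j)) (λ j → e (F.suc j)) ps (λ j → pr (F.suc j)) (λ j → ne (F.suc j)) y

  head∤tail : ∀ R (p e : Fin (suc R) → ℕ) → (∀ j → Prime (p j)) → Distinct (suc R) p →
    ¬ p F.zero ∣ prodF R (λ j → p (F.suc j) ^ e (F.suc j))
  head∤tail R p e pr d = prime∤prodF R (λ j → p (F.suc j)) (λ j → e (F.suc j)) (pr F.zero) (λ j → pr (F.suc j))
    (λ j eq → FP.0≢1+n (d F.zero (F.suc j) eq))

  pairwise-coprime : ∀ R (p a : Fin R → ℕ) → (∀ i → Prime (p i)) → Distinct R p → PairwiseCoprime R (λ i → p i ^ a i)
  pairwise-coprime zero p a pr d = tt
  pairwise-coprime (suc R) p a pr d = pow-coprime (a F.zero) (pr F.zero) (head∤tail R p a pr d)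
    , pairwise-coprime R (λ i → p (F.suc i)) (λ i → a (F.suc i)) (λ i → pr (F.suc i)) (distinct-tail R p d)

  powers-∣ : ∀ R (p c : Fin R → ℕ) x → (∀ i → Prime (p i)) → Distinct R p →
    (∀ i → p i ^ c i ∣ x) → prodF R (λ i → p i ^ c i) ∣ x
  powers-∣ zero p c x pr d h = 1∣ x
  powers-∣ (suc R) p c x pr d h =
    pow-coprime (c F.zero) (pr F.zero) (head∤tail R p c pr d) x (h F.zero)
      (powers-∣ R (λ i → p (F.suc i)) (λ i → c (F.suc i)) x (λ i → pr (F.suc i)) (distinct-tail R p d) (λ i → h (F.suc i)))

  valuation : ∀ R (p c : Fin R → ℕ) → (∀ i → Prime (p i)) → Distinct R p →
    ∀ i → ¬ p i ^ suc (c i) ∣ prodF R (λ j → p j ^ c j)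
  valuation (suc R) p c pr d F.zero h =
    head∤tail R p c pr d (*-cancelˡ-∣ (p F.zero ^ c F.zero) {{>-nonZero (pow≥1 _ (c F.zero) (<⇒≤ (prime>1 (pr F.zero))))}}
      (subst (_∣ (p F.zero ^ c F.zero * prodF R (λ j → p (F.suc j) ^ c (F.suc j)))) (*-comm (p F.zero) (p F.zero ^ c F.zero)) h))
  valuation (suc R) p c pr d (F.suc i) h =
    valuation R (λ j → p (F.suc j)) (λ j → c (F.suc j)) (λ j → pr (F.suc j)) (distinct-tail R p d) i
      (pow-∣-cancelʳ (suc (c (F.suc i))) _ (pr (F.suc i)) p∤head
        (subst (p (F.suc i) ^ suc (c (F.suc i)) ∣_) (*-comm (p F.zero ^ c F.zero) (prodF R (λ j → p (F.suc j) ^ c (F.suc j)))) h))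
    where
    p∤head : ¬ p (F.suc i) ∣ p F.zero ^ c F.zero
    p∤head q = FP.0≢1+n (d F.zero (F.suc i) (sym (prime-∣-prime (pr (F.suc i)) (pr F.zero) (prime-∣-pow _ (c F.zero) (pr (F.suc i)) q))))

  lower-exponents : ∀ R (p a c : Fin R → ℕ) K d → (∀ i → Prime (p i)) → (∀ i → c i ≤ a i) →
    d ∣ K * prodF R (λ i → p i ^ a i) → (∀ i → c i ≡ a i ⊎ ¬ p i ^ suc (c i) ∣ d) →
    d ∣ K * prodF R (λ i → p i ^ c i)
  lower-exponents zero p a c K d pr le h hc = h
  lower-exponents (suc R) p a c K d pr le h hc =
    subst (d ∣_) (*-assoc K (p F.zero ^ c F.zero) Mc)
      (lower-exponents R (λ i → p (F.suc i)) (λ i → a (F.suc i)) (λ i → c (F.suc i)) (K * p F.zero ^ c F.zero) d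
        (λ i → pr (F.suc i)) (λ i → le (F.suc i))
        (subst (d ∣_) (x∙yz≈yx∙z (p F.zero ^ c F.zero) K Ma)
          (lower-exponent (a F.zero) (c F.zero) (pr F.zero) (le F.zero) (subst (d ∣_) (x∙yz≈y∙xz K (p F.zero ^ a F.zero) Ma) h) (hc F.zero)))
        (λ i → hc (F.suc i)))
    where
    Ma Mc : ℕ
    Ma = prodF R (λ i → p (F.suc i) ^ a (F.suc i))
    Mc = prodF R (λ i → p (F.suc i) ^ c (F.suc i))

-- The congruence a ≡ b [mod n] of
-- Defs is unsigned divisibility of +a - +b; we work with the signed form,
-- where sums, differences and integer multipliers are available.
module Congruence where

  open import Defs using (_≡_[mod_])
  open import Data.Nat using (_+_; _*_; _≤_; >-nonZero)
  open import Data.Nat.Properties using (≤-trans; m≤n+m)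
  open import Data.Nat.Divisibility using (_∣_; divides; ∣-refl; ∣n⇒∣m*n)
  open import Data.Nat.GCD using (gcd; gcd-GCD; module Bézout)
  import Data.Integer as ℤ
  open import Data.Integer using (ℤ; +_)
  import Data.Integer.Properties as ℤP
  import Data.Integer.DivMod as ℤD
  import Data.Integer.Divisibility.Signed as S
  open S using () renaming (_∣_ to _∣ℤ_)
  open import Data.Integer.Tactic.RingSolver using (solve-∀)
  open import Data.Product using (∃; ∃₂; _×_; _,_)
  open import Relation.Binary.PropositionalEquality

  signed : ∀ {a b n} → a ≡ b [mod n ] → + n ∣ℤ (+ a ℤ.- + b)
  signed = S.∣ᵤ⇒∣

  unsigned : ∀ {a b n} → + n ∣ℤ (+ a ℤ.- + b) → a ≡ b [mod n ]
  unsigned = S.∣⇒∣ᵤ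

  lift : ∀ {d n} → d ∣ n → + d ∣ℤ + n
  lift = S.∣ᵤ⇒∣

  mod-sym : ∀ {a b n} → a ≡ b [mod n ] → b ≡ a [mod n ]
  mod-sym {a} {b} h = unsigned {b} {a} (subst (_ ∣ℤ_) (negate-diff (+ a) (+ b)) (S.∣m⇒∣-m (signed {a} {b} h)))
    where
    negate-diff : ∀ x y → ℤ.- (x ℤ.- y) ≡ y ℤ.- x
    negate-diff = solve-∀

  mod-∣ : ∀ {a b n d} → a ≡ b [mod n ] → d ∣ n → d ∣ b → d ∣ a
  mod-∣ {a} {b} h d∣n d∣b = S.∣⇒∣ᵤ (subst (_ ∣ℤ_) (cancel (+ a) (+ b))
    (S.∣m∣n⇒∣m+n (S.∣-trans (lift d∣n) (signed {a} {b} h)) (lift d∣b)))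
    where
    cancel : ∀ x y → (x ℤ.- y) ℤ.+ y ≡ x
    cancel = solve-∀

  positive-multiplier : ∀ {n a} x (t : ℤ) → 1 ≤ n → + n ∣ℤ (+ a ℤ.- t ℤ.* + x) →
    ∃ λ k → 1 ≤ k × a ≡ k * x [mod n ]
  positive-multiplier {n} {a} x t n≥1 h = k , ≤-trans n≥1 (m≤n+m n r) , unsigned {a} {k * x} n∣a-kx
    where
    instance _ = >-nonZero n≥1
    r k : ℕ
    r = t ℤD.%ℕ n
    k = r + n
    q : ℤ
    q = t ℤD./ℕ n
    k-t : + k ℤ.- t ≡ + n ℤ.- q ℤ.* + n
    k-t = trans (cong₂ ℤ._-_ (ℤP.pos-+ r n) (ℤD.a≡a%ℕn+[a/ℕn]*n t n)) (shift (+ r) (+ n) q)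
      where
      shift : ∀ r n q → (r ℤ.+ n) ℤ.- (r ℤ.+ q ℤ.* n) ≡ n ℤ.- q ℤ.* n
      shift = solve-∀
    n∣k-t : + n ∣ℤ (+ k ℤ.- t)
    n∣k-t = subst (_ ∣ℤ_) (sym k-t) (S.∣m∣n⇒∣m-n S.∣-refl (S.∣n⇒∣m*n q S.∣-refl))
    n∣a-kx : + n ∣ℤ (+ a ℤ.- + (k * x))
    n∣a-kx = subst (_ ∣ℤ_) (trans (regroup (+ a) t (+ k) (+ x)) (cong (λ z → + a ℤ.- z) (sym (ℤP.pos-* k x))))
      (S.∣m∣n⇒∣m-n h (S.∣m⇒∣m*n (+ x) n∣k-t))
      where
      regroup : ∀ a t k x → (a ℤ.- t ℤ.* x) ℤ.- (k ℤ.- t) ℤ.* x ≡ a ℤ.- k ℤ.* x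
      regroup = solve-∀

  cast : ∀ {g y n x u} → g + y * n ≡ x * u → + g ≡ + x ℤ.* + u ℤ.- + y ℤ.* + n
  cast {g} {y} {n} {x} {u} e = trans (rearrange (+ g) (+ y ℤ.* + n)) (cong (ℤ._- (+ y ℤ.* + n)) lifted)
    where
    rearrange : ∀ g z → g ≡ (g ℤ.+ z) ℤ.- z
    rearrange = solve-∀
    lifted : + g ℤ.+ + y ℤ.* + n ≡ + x ℤ.* + u
    lifted = trans (cong (λ z → + g ℤ.+ z) (sym (ℤP.pos-* y n)))
               (trans (sym (ℤP.pos-+ g (y * n))) (trans (cong +_ e) (ℤP.pos-* x u)))

  bezout : ∀ u n → ∃₂ λ t s → + gcd u n ≡ t ℤ.* + u ℤ.+ s ℤ.* + n
  bezout u n with Bézout.identity (gcd-GCD u n)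
  ... | Bézout.+- x y eq = + x , ℤ.- + y , trans (cast {gcd u n} {y} {n} {x} {u} eq) (form₁ (+ x) (+ u) (+ y) (+ n))
    where
    form₁ : ∀ x u y n → x ℤ.* u ℤ.- y ℤ.* n ≡ x ℤ.* u ℤ.+ ℤ.- y ℤ.* n
    form₁ = solve-∀
  ... | Bézout.-+ x y eq = ℤ.- + x , + y , trans (cast {gcd u n} {x} {u} {y} {n} eq) (form₂ (+ y) (+ n) (+ x) (+ u))
    where
    form₂ : ∀ y n x u → y ℤ.* n ℤ.- x ℤ.* u ≡ ℤ.- x ℤ.* u ℤ.+ y ℤ.* n
    form₂ = solve-∀

  multiple-of-divisor : ∀ {n u v A} → 1 ≤ n → v ≡ A [mod n ] → A ∣ u → ∃ λ k → 1 ≤ k × u ≡ k * v [mod n ]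
  multiple-of-divisor {n} {u} {v} {A} n≥1 hv (divides w refl) =
    positive-multiplier v (+ w) n≥1 (subst (_ ∣ℤ_) (sym diff) (S.∣n⇒∣m*n (+ w) (signed {A} {v} (mod-sym {v} {A} hv))))
    where
    factor : ∀ w A v → w ℤ.* A ℤ.- w ℤ.* v ≡ w ℤ.* (A ℤ.- v)
    factor = solve-∀
    diff : + (w * A) ℤ.- + w ℤ.* + v ≡ + w ℤ.* (+ A ℤ.- + v)
    diff = trans (cong (ℤ._- (+ w ℤ.* + v)) (ℤP.pos-* w A)) (factor (+ w) (+ A) (+ v))

  multiple-of-gcd-divisor : ∀ {n u v A} → 1 ≤ n → v ≡ A [mod n ] → gcd u n ∣ A → ∃ λ k → 1 ≤ k × v ≡ k * u [mod n ]
  multiple-of-gcd-divisor {n} {u} {v} {A} n≥1 hv (divides w refl) with bezout u n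
  ... | t , s , g≡ = positive-multiplier u (+ w ℤ.* t) n≥1
          (subst (_ ∣ℤ_) (sym diff) (S.∣m∣n⇒∣m+n (signed {v} {w * gcd u n} hv) (S.∣n⇒∣m*n (+ w ℤ.* s) S.∣-refl)))
    where
    regroup : ∀ v w g t s u n → g ≡ t ℤ.* u ℤ.+ s ℤ.* n →
      v ℤ.- (w ℤ.* t) ℤ.* u ≡ (v ℤ.- w ℤ.* g) ℤ.+ (w ℤ.* s) ℤ.* n
    regroup v w g t s u n refl = identity v w t s u n
      where
      identity : ∀ v w t s u n → v ℤ.- (w ℤ.* t) ℤ.* u ≡ (v ℤ.- w ℤ.* (t ℤ.* u ℤ.+ s ℤ.* n)) ℤ.+ (w ℤ.* s) ℤ.* n
      identity = solve-∀
    diff : + v ℤ.- (+ w ℤ.* t) ℤ.* + u ≡ (+ v ℤ.- + (w * gcd u n)) ℤ.+ (+ w ℤ.* s) ℤ.* + n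
    diff = trans (regroup (+ v) (+ w) (+ gcd u n) t s (+ u) (+ n) g≡)
                 (cong (λ z → (+ v ℤ.- z) ℤ.+ (+ w ℤ.* s) ℤ.* + n) (sym (ℤP.pos-* w (gcd u n))))

  multiple⇒divisor-∣ : ∀ {n u v A k} → v ≡ A [mod n ] → A ∣ n → u ≡ k * v [mod n ] → A ∣ u
  multiple⇒divisor-∣ {k = k} hv A∣n hu = mod-∣ hu A∣n (∣n⇒∣m*n k (mod-∣ hv A∣n ∣-refl))

  multiple⇒common-divisor-∣ : ∀ {n u v A k d} → v ≡ A [mod n ] → v ≡ k * u [mod n ] → d ∣ n → d ∣ u → d ∣ A
  multiple⇒common-divisor-∣ {n} {u} {v} {A} {k} hv hu d∣n d∣u = mod-∣ (mod-sym {v} {A} {n} hv) d∣n (mod-∣ hu d∣n (∣n⇒∣m*n k d∣u))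

-- Local conditions at one prime power p^a, for a target exponent c ≤ a:
-- "p^c ∣ t" (t is a multiple) and "c = a or p^(c+1) ∤ t" (the p-part of
-- gcd(t, p^a) divides p^c), together with their counts on [0, p^a).
module LocalCounts where

  open import Data.Nat
  open import Data.Nat.Properties
  open import Data.Nat.Divisibility
  open import Data.Bool using (Bool; true; _∧_; _∨_; not; T)
  open import Data.Bool.Properties using (∧-identityʳ; T-≡)
  open import Function.Bundles using (Equivalence)
  open import Data.Nat.Tactic.RingSolver using (solve-∀)
  open import Data.Sum using (inj₁; inj₂)
  open import Relation.Nullary.Decidable using (isYes; toWitness; fromWitness)
  open import Relation.Binary.PropositionalEquality
  open Counting
  open PrimePowers using (pow≥1; pow-∣-pow)

  divides? : ℕ → ℕ → Bool
  divides? d t = isYes (d ∣? t)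

  divides?⇒∣ : ∀ {d t} → T (divides? d t) → d ∣ t
  divides?⇒∣ {d} {t} = toWitness {a? = d ∣? t}

  ∣⇒divides? : ∀ {d t} → d ∣ t → T (divides? d t)
  ∣⇒divides? {d} {t} = fromWitness {a? = d ∣? t}

  capped? : ℕ → ℕ → ℕ → ℕ → Bool
  capped? p a c t = (c ≡ᵇ a) ∨ not (divides? (p ^ suc c) t)

  locP locL locE : ℕ → ℕ → ℕ → ℕ
  locP p a c = cnt (p ^ a) (divides? (p ^ c))
  locL p a c = cnt (p ^ a) (capped? p a c)
  locE p a c = cnt (p ^ a) (λ t → divides? (p ^ c) t ∧ capped? p a c t)

  cnt-multiples : ∀ d e → 1 ≤ d → cnt (d * e) (divides? d) ≡ e
  cnt-multiples d zero _ = cong (λ z → cnt z (divides? d)) (*-zeroʳ d)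
  cnt-multiples d@(suc d') (suc e) d≥1 = begin
      cnt (d * suc e) (divides? d)                              ≡⟨ cong (λ z → cnt z (divides? d)) (*-suc d e) ⟩
      cnt (d + d * e) (divides? d)                              ≡⟨ cnt-+ d (d * e) (divides? d) ⟩
      cnt d (divides? d) + cnt (d * e) (λ u → divides? d (d + u)) ≡⟨ cong₂ _+_ first-block (cnt-ext (d * e) (λ u _ → shift u)) ⟩
      1 + cnt (d * e) (divides? d)                              ≡⟨ cong suc (cnt-multiples d e d≥1) ⟩
      suc e ∎
    where
    open ≡-Reasoning
    first-block : cnt d (divides? d) ≡ 1
    first-block = cong suc (cnt-false d' _ (λ u u<d' →
      T-ext (λ h → <⇒≱ (s≤s u<d') (∣⇒≤ (divides?⇒∣ h))) (λ ())))
    shift : ∀ u → divides? d (d + u) ≡ divides? d u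
    shift u = T-ext (λ h → ∣⇒divides? (∣m+n∣m⇒∣n (divides?⇒∣ h) ∣-refl))
                    (λ h → ∣⇒divides? (∣m∣n⇒∣m+n ∣-refl (divides?⇒∣ h)))

  pow-split : ∀ p {x y} → x ≤ y → p ^ y ≡ p ^ x * p ^ (y ∸ x)
  pow-split p {x} {y} x≤y = trans (cong (p ^_) (sym (m+[n∸m]≡n x≤y))) (^-distribˡ-+-* p x (y ∸ x))

  locP-value : ∀ p a c → 1 ≤ p → c ≤ a → locP p a c ≡ p ^ (a ∸ c)
  locP-value p a c p≥1 c≤a = trans (cong (λ z → cnt z (divides? (p ^ c))) (pow-split p c≤a))
                                   (cnt-multiples (p ^ c) _ (pow≥1 p c p≥1))

  locP-top : ∀ p a → 1 ≤ p → locP p a a ≡ 1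
  locP-top p a p≥1 = trans (locP-value p a a p≥1 ≤-refl) (cong (p ^_) (n∸n≡0 a))

  capped?-top : ∀ p a t → capped? p a a t ≡ true
  capped?-top p a t = cong (_∨ not (divides? (p ^ suc a) t)) (Equivalence.to T-≡ (≡⇒≡ᵇ a a refl))

  capped?-below : ∀ p a c t → c < a → capped? p a c t ≡ not (divides? (p ^ suc c) t)
  capped?-below p a c t c<a = cong (_∨ not (divides? (p ^ suc c) t)) (T-ext (λ e → <-irrefl (≡ᵇ⇒≡ c a e) c<a) (λ ()))

  locL-top : ∀ p a → locL p a a ≡ p ^ a
  locL-top p a = cnt-true (p ^ a) _ (λ t _ → capped?-top p a t)

  locE-top : ∀ p a → 1 ≤ p → locE p a a ≡ 1
  locE-top p a p≥1 = trans (cnt-ext (p ^ a) (λ t _ → trans (cong (divides? (p ^ a) t ∧_) (capped?-top p a t)) (∧-identityʳ _)))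
                           (locP-top p a p≥1)

  -- For c < a, the complement of the cap condition is "p^(c+1) ∣ t",
  -- which has p^(a-c-1) solutions.
  locL-below : ∀ p a c → 1 ≤ p → c < a → locL p a c + p ^ (a ∸ suc c) ≡ p ^ a
  locL-below p a c p≥1 c<a = begin
      locL p a c + p ^ (a ∸ suc c)                      ≡⟨ cong₂ _+_ (cnt-ext (p ^ a) (λ t _ → capped?-below p a c t c<a)) (sym (locP-value p a (suc c) p≥1 c<a)) ⟩
      cnt (p ^ a) (λ t → not (D t)) + cnt (p ^ a) D     ≡⟨ +-comm (cnt (p ^ a) (λ t → not (D t))) _ ⟩
      cnt (p ^ a) D + cnt (p ^ a) (λ t → true ∧ not (D t)) ≡⟨ sym (cnt-difference (p ^ a) (λ _ → true) D (λ _ _ → _)) ⟩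
      cnt (p ^ a) (λ _ → true)                          ≡⟨ cnt-true (p ^ a) _ (λ _ _ → refl) ⟩
      p ^ a ∎
    where
    open ≡-Reasoning
    D : ℕ → Bool
    D = divides? (p ^ suc c)

  locE-below : ∀ p a c → 1 ≤ p → c < a → locE p a c + p ^ (a ∸ suc c) ≡ p ^ (a ∸ c)
  locE-below p a c p≥1 c<a = begin
      locE p a c + p ^ (a ∸ suc c)                             ≡⟨ cong₂ _+_ (cnt-ext (p ^ a) (λ t _ → cong (Dc t ∧_) (capped?-below p a c t c<a))) (sym (locP-value p a (suc c) p≥1 c<a)) ⟩
      cnt (p ^ a) (λ t → Dc t ∧ not (Dc+1 t)) + cnt (p ^ a) Dc+1 ≡⟨ +-comm (cnt (p ^ a) (λ t → Dc t ∧ not (Dc+1 t))) _ ⟩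
      cnt (p ^ a) Dc+1 + cnt (p ^ a) (λ t → Dc t ∧ not (Dc+1 t)) ≡⟨ sym (cnt-difference (p ^ a) Dc Dc+1 (λ t h → ∣⇒divides? (∣-trans (pow-∣-pow p (n≤1+n c)) (divides?⇒∣ h)))) ⟩
      cnt (p ^ a) Dc                                          ≡⟨ locP-value p a c p≥1 (<⇒≤ c<a) ⟩
      p ^ (a ∸ c) ∎
    where
    open ≡-Reasoning
    Dc Dc+1 : ℕ → Bool
    Dc = divides? (p ^ c)
    Dc+1 = divides? (p ^ suc c)

  -- Local inclusion–exclusion: the two conditions cover [0, p^a).
  locL+locP : ∀ p a c → 1 ≤ p → c ≤ a → locL p a c + locP p a c ≡ locE p a c + p ^ a
  locL+locP p a c p≥1 c≤a with m≤n⇒m<n∨m≡n c≤a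
  ... | inj₂ refl = trans (cong₂ _+_ (locL-top p c) (locP-top p c p≥1))
                          (trans (+-comm (p ^ c) 1) (cong (_+ p ^ c) (sym (locE-top p c p≥1))))
  ... | inj₁ c<a = +-cancelʳ-≡ r _ _ (begin
      (locL p a c + locP p a c) + r  ≡⟨ swap (locL p a c) (locP p a c) r ⟩
      (locL p a c + r) + locP p a c  ≡⟨ cong₂ _+_ (locL-below p a c p≥1 c<a) (trans (locP-value p a c p≥1 c≤a) (sym (locE-below p a c p≥1 c<a))) ⟩
      p ^ a + (locE p a c + r)       ≡⟨ rotate (p ^ a) (locE p a c) r ⟩
      (locE p a c + p ^ a) + r ∎)
    where
    open ≡-Reasoning
    r : ℕ
    r = p ^ (a ∸ suc c)
    swap : ∀ x y z → (x + y) + z ≡ (x + z) + y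
    swap = solve-∀
    rotate : ∀ x y z → x + (y + z) ≡ (y + x) + z
    rotate = solve-∀

  -- At exponent 0 (and a ≥ 1) the E- and L-counts agree: both count the
  -- t < p^a prime to p, of which there are (p-1)·p^(a-1).
  locE-zero : ∀ p a → 1 ≤ p → 1 ≤ a → locE p a 0 ≡ pred p * p ^ pred a
  locE-zero (suc p') (suc a') _ _ = +-cancelʳ-≡ (suc p' ^ a') _ _ (trans (locE-below (suc p') (suc a') 0 (s≤s z≤n) (s≤s z≤n)) (+-comm (suc p' ^ a') _))

  locL-zero : ∀ p a → 1 ≤ p → 1 ≤ a → locL p a 0 ≡ pred p * p ^ pred a
  locL-zero (suc p') (suc a') _ _ = +-cancelʳ-≡ (suc p' ^ a') _ _ (trans (locL-below (suc p') (suc a') 0 (s≤s z≤n) (s≤s z≤n)) (+-comm (suc p' ^ a') _))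

  ∸-step : ∀ {c a} → c < a → a ∸ c ≡ suc (a ∸ suc c)
  ∸-step {zero} {suc a} _ = refl
  ∸-step {suc c} {suc a} (s≤s c<a) = ∸-step c<a

  locP-below : ∀ p' a c → c < a → locP (suc p') a c ≡ suc p' * suc p' ^ (a ∸ suc c)
  locP-below p' a c c<a = trans (locP-value (suc p') a c (s≤s z≤n) (<⇒≤ c<a)) (cong (suc p' ^_) (∸-step c<a))

  locE-below′ : ∀ p' a c → c < a → locE (suc p') a c ≡ p' * suc p' ^ (a ∸ suc c)
  locE-below′ p' a c c<a = +-cancelʳ-≡ r _ _ (trans (locE-below (suc p') a c (s≤s z≤n) c<a)
                                                 (trans (cong (suc p' ^_) (∸-step c<a)) (+-comm r (p' * r))))
    where
    r : ℕ
    r = suc p' ^ (a ∸ suc c)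

  locL≡locE-zero : ∀ p a → 1 ≤ p → 1 ≤ a → locL p a 0 ≡ locE p a 0
  locL≡locE-zero p a p≥1 a≥1 = trans (locL-zero p a p≥1 a≥1) (sym (locE-zero p a p≥1 a≥1))

  locE≤locP-zero : ∀ p a → 1 ≤ p → 1 ≤ a → locE p a 0 ≤ locP p a 0
  locE≤locP-zero p (suc a') p≥1 _ = subst (locE p (suc a') 0 ≤_)
    (trans (locE-below p (suc a') 0 p≥1 (s≤s z≤n)) (sym (locP-value p (suc a') 0 p≥1 z≤n))) (m≤m+n _ _)

module Degree where

  open import Defs
  open import Data.Nat
  open import Data.Nat.Properties
  open import Data.Nat.DivMod
  open import Data.Nat.Divisibility
  open import Data.Nat.Primality using (Prime)
  open import Data.Nat.GCD using (gcd; gcd[m,n]∣m; gcd[m,n]∣n)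
  open import Data.Bool using (Bool; true; false; _∧_; _∨_; not; T)
  open import Data.Bool.Properties using (T-∧; T-∨)
  open import Data.Fin using (Fin; toℕ)
  import Data.Fin as F
  import Data.Fin.Properties as FP
  open import Data.Fin.Subset using (Subset; _∈_; ∣_∣)
  open import Data.Vec using ([]; _∷_; here; there)
  open import Data.Product using (_×_; _,_; proj₁; proj₂)
  open import Data.Sum using (_⊎_; inj₁; inj₂)
  open import Data.Empty using (⊥-elim)
  open import Function.Bundles using (_⇔_; mk⇔; Equivalence)
  open import Relation.Nullary using (¬_; yes; no)
  open import Relation.Binary.PropositionalEquality
  open Counting
  open CRT
  open PrimePowers
  open Congruence
  open LocalCounts

  card≡cnt : ∀ n (S : Subset n) (g : ℕ → Bool) →
    (∀ i → (i ∈ S → T (g (toℕ i))) × (T (g (toℕ i)) → i ∈ S)) → ∣ S ∣ ≡ cnt n g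
  card≡cnt zero [] g h = refl
  card≡cnt (suc n) (x ∷ S) g h = trans (size-∷ x) (cong₂ _+_ (cong b2n head) (card≡cnt n S (λ u → g (suc u)) tail))
    where
    size-∷ : ∀ x → ∣ x ∷ S ∣ ≡ b2n x + ∣ S ∣
    size-∷ true = refl
    size-∷ false = refl
    member : ∀ {x} → T x → F.zero ∈ (x ∷ S)
    member {true} _ = here
    inside : ∀ {x} → F.zero ∈ (x ∷ S) → T x
    inside here = _
    head : x ≡ g 0
    head = T-ext (λ t → proj₁ (h F.zero) (member t)) (λ t → inside (proj₂ (h F.zero) t))
    tail : ∀ i → (i ∈ S → T (g (suc (toℕ i)))) × (T (g (suc (toℕ i))) → i ∈ S)
    tail i = (λ m → proj₁ (h (F.suc i)) (there m)) , (λ t → drop (proj₂ (h (F.suc i)) t))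
      where
      drop : F.suc i ∈ (x ∷ S) → i ∈ S
      drop (there m) = m

  deg+1≡cnt : ∀ n (v : Fin n) d (NB : ℕ → Bool) →
    (∀ u → Adj n u v → T (NB (toℕ u))) →
    (∀ u → u ≢ v → T (NB (toℕ u)) → Adj n u v) →
    T (NB (toℕ v)) → Deg n v d → d + 1 ≡ cnt n NB
  deg+1≡cnt n v d NB adj⇒NB NB⇒adj NBv (S , S≡N , refl) = begin
      ∣ S ∣ + 1                                             ≡⟨ cong (_+ 1) (card≡cnt n S others membership) ⟩
      cnt n others + 1                                      ≡⟨ +-comm (cnt n others) 1 ⟩
      1 + cnt n others                                      ≡⟨ cong (_+ cnt n others) (sym (trans (cnt-point n (toℕ v) NB (FP.toℕ<n v)) (b2n-T NBv))) ⟩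
      cnt n (λ u → NB u ∧ (u ≡ᵇ toℕ v)) + cnt n others      ≡⟨ sym (cnt-split n NB (λ u → u ≡ᵇ toℕ v)) ⟩
      cnt n NB ∎
    where
    open ≡-Reasoning
    others : ℕ → Bool
    others u = NB u ∧ not (u ≡ᵇ toℕ v)
    b2n-T : ∀ {x} → T x → b2n x ≡ 1
    b2n-T {true} _ = refl
    membership : ∀ i → (i ∈ S → T (others (toℕ i))) × (T (others (toℕ i)) → i ∈ S)
    membership i =
      (λ m → let adj = proj₁ (S≡N i) m in
             Equivalence.from T-∧ (adj⇒NB i adj , T-not⁺ (λ e → proj₁ adj (FP.toℕ-injective (≡ᵇ⇒≡ _ _ e)))))
      , (λ t → let (nb , ne) = Equivalence.to T-∧ t in
               proj₂ (S≡N i) (NB⇒adj i (λ e → T-not⁻ ne (≡⇒≡ᵇ _ _ (cong toℕ e))) nb))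

  T-allF : ∀ R (b : Fin R → Bool) → T (allF R b) ⇔ (∀ i → T (b i))
  T-allF zero b = mk⇔ (λ _ ()) (λ _ → _)
  T-allF (suc R) b = mk⇔
    (λ t → let (t₀ , ts) = Equivalence.to T-∧ t in λ { F.zero → t₀ ; (F.suc i) → Equivalence.to (T-allF R _) ts i })
    (λ h → Equivalence.from T-∧ (h F.zero , Equivalence.from (T-allF R _) (λ i → h (F.suc i))))

  allF-∧ : ∀ R (b c : Fin R → Bool) → allF R (λ i → b i ∧ c i) ≡ allF R b ∧ allF R c
  allF-∧ R b c = T-ext
    (λ t → let h = Equivalence.to (T-allF R _) t in
           Equivalence.from T-∧ ( Equivalence.from (T-allF R b) (λ i → proj₁ (Equivalence.to T-∧ (h i)))
                                , Equivalence.from (T-allF R c) (λ i → proj₂ (Equivalence.to T-∧ (h i)))))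
    (λ t → let (tb , tc) = Equivalence.to T-∧ t in
           Equivalence.from (T-allF R _) (λ i → Equivalence.from T-∧ (Equivalence.to (T-allF R b) tb i , Equivalence.to (T-allF R c) tc i)))

  residue-∣ : ∀ {d q} u .{{_ : NonZero q}} → d ∣ q → T (divides? d (u % q)) ⇔ d ∣ u
  residue-∣ u d∣q = mk⇔ (λ t → ∣n∣m%n⇒∣m d∣q (divides?⇒∣ t)) (λ d∣u → ∣⇒divides? (%-presˡ-∣ d∣u d∣q))

  prodF-∣-prodF : ∀ R (f g : Fin R → ℕ) → (∀ i → f i ∣ g i) → prodF R f ∣ prodF R g
  prodF-∣-prodF zero f g h = ∣-refl
  prodF-∣-prodF (suc R) f g h = *-pres-∣ (h F.zero) (prodF-∣-prodF R (λ i → f (F.suc i)) (λ i → g (F.suc i)) (λ i → h (F.suc i)))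

  module Formula (R : ℕ) (p a c : Fin R → ℕ) (pr : ∀ i → Prime (p i)) (dist : Distinct R p)
                 (c≤a : ∀ i → c i ≤ a i) where

    q : Fin R → ℕ
    q i = p i ^ a i

    q≥1 : ∀ i → 1 ≤ q i
    q≥1 i = pow≥1 (p i) (a i) (<⇒≤ (prime>1 (pr i)))

    instance
      q≢0 : ∀ {i} → NonZero (q i)
      q≢0 {i} = >-nonZero (q≥1 i)

    n : ℕ
    n = prodF R q

    A : ℕ
    A = prodF R (λ i → p i ^ c i)

    A∣n : A ∣ n
    A∣n = prodF-∣-prodF R _ _ (λ i → pow-∣-pow (p i) (c≤a i))

    -- "cᵢ = aᵢ or pᵢ^(cᵢ+1) ∤ u": the pᵢ-part of gcd(u, n) divides A.
    Capped : Fin R → ℕ → Set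
    Capped i u = c i ≡ a i ⊎ ¬ p i ^ suc (c i) ∣ u

    -- X: multiples of A;  Y: the u with gcd(u, n) ∣ A;  NB = X ∪ Y.
    X Y NB : ℕ → Bool
    X u = allF R (λ i → divides? (p i ^ c i) (u % q i))
    Y u = allF R (λ i → capped? (p i) (a i) (c i) (u % q i))
    NB u = X u ∨ Y u

    capped-residue : ∀ i u → T (capped? (p i) (a i) (c i) (u % q i)) ⇔ Capped i u
    capped-residue i u with c i ≟ a i
    ... | yes c≡a = mk⇔ (λ _ → inj₁ c≡a) (λ _ → Equivalence.from T-∨ (inj₁ (≡⇒≡ᵇ (c i) (a i) c≡a)))
    ... | no c≢a = mk⇔
      (λ t → inj₂ (λ d → T-not⁻ (subst T (capped?-below (p i) (a i) (c i) _ c<a) t) (Equivalence.from multiple d)))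
      (λ { (inj₁ c≡a) → ⊥-elim (c≢a c≡a)
         ; (inj₂ p∤u) → subst T (sym (capped?-below (p i) (a i) (c i) _ c<a)) (T-not⁺ (λ t → p∤u (Equivalence.to multiple t))) })
      where
      c<a : c i < a i
      c<a = ≤∧≢⇒< (c≤a i) c≢a
      multiple : T (divides? (p i ^ suc (c i)) (u % q i)) ⇔ p i ^ suc (c i) ∣ u
      multiple = residue-∣ u (pow-∣-pow (p i) c<a)

    X⇔ : ∀ u → T (X u) ⇔ A ∣ u
    X⇔ u = mk⇔
      (λ t → powers-∣ R p c u pr dist (λ i → Equivalence.to (residue-∣ u (pow-∣-pow (p i) (c≤a i))) (Equivalence.to (T-allF R _) t i)))
      (λ A∣u → Equivalence.from (T-allF R _) (λ i → Equivalence.from (residue-∣ u (pow-∣-pow (p i) (c≤a i)))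
                   (∣-trans (prodF-factor R (λ j → p j ^ c j) i) A∣u)))

    Y⇔ : ∀ u → T (Y u) ⇔ (∀ i → Capped i u)
    Y⇔ u = mk⇔ (λ t i → Equivalence.to (capped-residue i u) (Equivalence.to (T-allF R _) t i))
               (λ h → Equivalence.from (T-allF R _) (λ i → Equivalence.from (capped-residue i u) (h i)))

    gcd∣A : ∀ u → (∀ i → Capped i u) → gcd u n ∣ A
    gcd∣A u h = subst (gcd u n ∣_) (*-identityˡ A)
      (lower-exponents R p a c 1 (gcd u n) pr c≤a (subst (gcd u n ∣_) (sym (*-identityˡ n)) (gcd[m,n]∣n u n))
        (λ i → Data.Sum.map₂ (λ p∤u d → p∤u (∣-trans d (gcd[m,n]∣m u n))) (h i)))

    -- The closed neighbourhood of the class v of A is exactly NB.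
    module _ (v : Fin n) (v≡A : toℕ v ≡ A [mod n ]) where

      neighbour⇒NB : ∀ u → Adj n u v → T (NB (toℕ u))
      neighbour⇒NB u (_ , inj₁ (k , _ , u≡kv)) =
        Equivalence.from T-∨ (inj₁ (Equivalence.from (X⇔ (toℕ u)) (multiple⇒divisor-∣ {n} {toℕ u} {toℕ v} {A} {k} v≡A A∣n u≡kv)))
      neighbour⇒NB u (_ , inj₂ (k , _ , v≡ku)) = Equivalence.from T-∨ (inj₂ (Equivalence.from (Y⇔ (toℕ u)) capped))
        where
        capped : ∀ i → Capped i (toℕ u)
        capped i with c i ≟ a i
        ... | yes c≡a = inj₁ c≡a
        ... | no c≢a = inj₂ (λ d → valuation R p c pr dist i
                (multiple⇒common-divisor-∣ {n} {toℕ u} {toℕ v} {A} {k} v≡A v≡ku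
                   (∣-trans (pow-∣-pow (p i) (≤∧≢⇒< (c≤a i) c≢a)) (prodF-factor R q i)) d))

      NB⇒neighbour : ∀ u → u ≢ v → T (NB (toℕ u)) → Adj n u v
      NB⇒neighbour u u≢v t with Equivalence.to T-∨ t
      ... | inj₁ x = u≢v , inj₁ (multiple-of-divisor n≥1 v≡A (Equivalence.to (X⇔ (toℕ u)) x))
        where n≥1 = prodF-pos R q q≥1
      ... | inj₂ y = u≢v , inj₂ (multiple-of-gcd-divisor n≥1 v≡A (gcd∣A (toℕ u) (Equivalence.to (Y⇔ (toℕ u)) y)))
        where n≥1 = prodF-pos R q q≥1

      NB-self : T (NB (toℕ v))
      NB-self = Equivalence.from T-∨ (inj₁ (Equivalence.from (X⇔ (toℕ v)) (mod-∣ v≡A A∣n ∣-refl)))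

    degree-formula : ∀ (v : Fin n) d → toℕ v ≡ A [mod n ] → Deg n v d →
      d + 1 + prodF R (λ i → locE (p i) (a i) (c i)) ≡ prodF R (λ i → locP (p i) (a i) (c i)) + prodF R (λ i → locL (p i) (a i) (c i))
    degree-formula v d v≡A deg = begin
        d + 1 + prodF R (λ i → locE (p i) (a i) (c i))  ≡⟨ cong₂ _+_ (deg+1≡cnt n v d NB (neighbour⇒NB v v≡A) (NB⇒neighbour v v≡A) (NB-self v v≡A) deg) (sym (crt _)) ⟩
        cnt n NB + cnt n (λ u → allF R (λ i → divides? (p i ^ c i) (u % q i) ∧ capped? (p i) (a i) (c i) (u % q i)))
                                                         ≡⟨ cong (cnt n NB +_) (cnt-ext n (λ u _ → allF-∧ R _ _)) ⟩
        cnt n NB + cnt n (λ u → X u ∧ Y u)               ≡⟨ cnt-∨ n X Y ⟩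
        cnt n X + cnt n Y                                ≡⟨ cong₂ _+_ (crt _) (crt _) ⟩
        prodF R (λ i → locP (p i) (a i) (c i)) + prodF R (λ i → locL (p i) (a i) (c i)) ∎
      where
      open ≡-Reasoning
      crt : (P : Fin R → ℕ → Bool) → cnt n (λ u → allF R (λ i → P i (u % q i))) ≡ prodF R (λ i → cnt (q i) (P i))
      crt = crtN R q q≥1 (pairwise-coprime R p a pr dist)

module Products where

  open import Defs using (prodF)
  open import Data.Nat
  open import Data.Nat.Properties
  open import Data.Fin using (Fin; punchIn)
  import Data.Fin as F
  import Data.Fin.Properties as FP
  open import Data.Empty using (⊥-elim)
  open import Relation.Binary.PropositionalEquality
  open import Algebra.Properties.CommutativeSemigroup *-commutativeSemigroup using (x∙yz≈y∙xz)

  prodF-ext : ∀ R {f g : Fin R → ℕ} → (∀ i → f i ≡ g i) → prodF R f ≡ prodF R g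
  prodF-ext zero h = refl
  prodF-ext (suc R) h = cong₂ _*_ (h F.zero) (prodF-ext R (λ i → h (F.suc i)))

  prodF-mono : ∀ R {f g : Fin R → ℕ} → (∀ i → f i ≤ g i) → prodF R f ≤ prodF R g
  prodF-mono zero h = ≤-refl
  prodF-mono (suc R) h = *-mono-≤ (h F.zero) (prodF-mono R (λ i → h (F.suc i)))

  prodF-one : ∀ R (f : Fin R → ℕ) → (∀ i → f i ≡ 1) → prodF R f ≡ 1
  prodF-one zero f h = refl
  prodF-one (suc R) f h = cong₂ _*_ (h F.zero) (prodF-one R _ (λ i → h (F.suc i)))

  prodF-split : ∀ R (f : Fin (suc R) → ℕ) i → prodF (suc R) f ≡ f i * prodF R (λ k → f (punchIn i k))
  prodF-split R f F.zero = refl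
  prodF-split (suc R) f (F.suc i) =
    trans (cong (f F.zero *_) (prodF-split R (λ k → f (F.suc k)) i)) (x∙yz≈y∙xz (f F.zero) (f (F.suc i)) _)

  prodF-split₂ : ∀ m (f : Fin (suc (suc m)) → ℕ) i j' →
    prodF (suc (suc m)) f ≡ f i * (f (punchIn i j') * prodF m (λ l → f (punchIn i (punchIn j' l))))
  prodF-split₂ m f i j' = trans (prodF-split (suc m) f i) (cong (f i *_) (prodF-split m (λ t → f (punchIn i t)) j'))

  δ : ∀ {R} → Fin R → ℕ → Fin R → ℕ
  δ F.zero e F.zero = e
  δ F.zero e (F.suc j) = 0
  δ (F.suc i) e F.zero = 0
  δ (F.suc i) e (F.suc j) = δ i e j

  δ-self : ∀ {R} (i : Fin R) e → δ i e i ≡ e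
  δ-self F.zero e = refl
  δ-self (F.suc i) e = δ-self i e

  δ-other : ∀ {R} (i j : Fin R) e → j ≢ i → δ i e j ≡ 0
  δ-other F.zero F.zero e ne = ⊥-elim (ne refl)
  δ-other F.zero (F.suc j) e ne = refl
  δ-other (F.suc i) F.zero e ne = refl
  δ-other (F.suc i) (F.suc j) e ne = δ-other i j e (λ eq → ne (cong F.suc eq))

  δ-≤ : ∀ {R} (a : Fin R → ℕ) (i : Fin R) e → e ≤ a i → ∀ j → δ i e j ≤ a j
  δ-≤ a F.zero e h F.zero = h
  δ-≤ a F.zero e h (F.suc j) = z≤n
  δ-≤ a (F.suc i) e h F.zero = z≤n
  δ-≤ a (F.suc i) e h (F.suc j) = δ-≤ (λ k → a (F.suc k)) i e h j

  prodF-δ : ∀ R (p : Fin (suc R) → ℕ) i e → prodF (suc R) (λ j → p j ^ δ i e j) ≡ p i ^ e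
  prodF-δ R p i e = trans (prodF-split R (λ j → p j ^ δ i e j) i)
    (trans (cong₂ _*_ (cong (p i ^_) (δ-self i e))
                      (prodF-one R _ (λ k → cong (p (punchIn i k) ^_) (δ-other i (punchIn i k) e (FP.punchInᵢ≢i i k)))))
           (*-identityʳ _))

  prodF-at-δ : ∀ R (W : Fin (suc R) → ℕ → ℕ) i e →
    prodF (suc R) (λ j → W j (δ i e j)) ≡ W i e * prodF R (λ k → W (punchIn i k) 0)
  prodF-at-δ R W i e = trans (prodF-split R (λ j → W j (δ i e j)) i)
    (cong₂ _*_ (cong (W i) (δ-self i e)) (prodF-ext R (λ k → cong (W (punchIn i k)) (δ-other i (punchIn i k) e (FP.punchInᵢ≢i i k)))))

-- Writing
--   F(c) = ∏ locP + ∏ locL   and   G(c) = ∏ locE,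
-- we have deg(A_c) = F(c) - G(c) - 1, so deg(A_c) ≥ deg(A_c') follows from
--   c ≽ c'  :=  F(c') + G(c) ≤ F(c) + G(c').
module Criterion (R : ℕ) (p a : Fin R → ℕ) (pr : ∀ i → Prime (p i)) (dist : PrimePowers.Distinct R p) where

  open import Data.Nat
  open import Data.Nat.Properties
  open import Data.Product using (_,_)
  open import Relation.Binary.PropositionalEquality
  open import Data.Nat.Tactic.RingSolver using (solve-∀)
  open LocalCounts

  F G : (Fin R → ℕ) → ℕ
  F c = prodF R (λ i → locP (p i) (a i) (c i)) + prodF R (λ i → locL (p i) (a i) (c i))
  G c = prodF R (λ i → locE (p i) (a i) (c i))

  _≽_ : (Fin R → ℕ) → (Fin R → ℕ) → Set
  c ≽ c' = F c' + G c ≤ F c + G c'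

  ≽-trans : ∀ c₁ c₂ c₃ → c₁ ≽ c₂ → c₂ ≽ c₃ → c₁ ≽ c₃
  ≽-trans c₁ c₂ c₃ h₁₂ h₂₃ = +-cancelˡ-≤ (F c₂ + G c₂) _ _ (begin
      (F c₂ + G c₂) + (F c₃ + G c₁) ≡⟨ shuffle₁ (F c₂) (G c₂) (F c₃) (G c₁) ⟩
      (F c₃ + G c₂) + (F c₂ + G c₁) ≤⟨ +-mono-≤ h₂₃ h₁₂ ⟩
      (F c₂ + G c₃) + (F c₁ + G c₂) ≡⟨ shuffle₂ (F c₂) (G c₃) (F c₁) (G c₂) ⟩
      (F c₂ + G c₂) + (F c₁ + G c₃) ∎)
    where
    open ≤-Reasoning
    shuffle₁ : ∀ x y z w → (x + y) + (z + w) ≡ (z + y) + (x + w)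
    shuffle₁ = solve-∀
    shuffle₂ : ∀ x y z w → (x + y) + (z + w) ≡ (x + w) + (z + y)
    shuffle₂ = solve-∀

  n : ℕ
  n = prodF R (λ i → p i ^ a i)

  A : (Fin R → ℕ) → ℕ
  A c = prodF R (λ i → p i ^ c i)

  ≽⇒DegGe : ∀ c c' → (∀ i → c i ≤ a i) → (∀ i → c' i ≤ a i) → c ≽ c' → DegGe n (A c) (A c')
  ≽⇒DegGe c c' c≤a c'≤a c≽c' d d' (v , v≡A , deg) (v' , v'≡A' , deg') =
    +-cancelʳ-≤ (1 + G c + G c') d' d (begin
      d' + (1 + G c + G c')  ≡⟨ shuffle₁ d' (G c) (G c') ⟩
      (d' + 1 + G c') + G c ≡⟨ cong (_+ G c) (Degree.Formula.degree-formula R p a c' pr dist c'≤a v' d' v'≡A' deg') ⟩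
      F c' + G c            ≤⟨ c≽c' ⟩
      F c + G c'            ≡⟨ cong (_+ G c') (sym (Degree.Formula.degree-formula R p a c pr dist c≤a v d v≡A deg)) ⟩
      (d + 1 + G c) + G c'  ≡⟨ shuffle₂ d (G c) (G c') ⟩
      d + (1 + G c + G c') ∎)
    where
    open ≤-Reasoning
    shuffle₁ : ∀ x y z → x + (1 + y + z) ≡ (x + 1 + z) + y
    shuffle₁ = solve-∀
    shuffle₂ : ∀ x y z → (x + 1 + y) + z ≡ x + (1 + y + z)
    shuffle₂ = solve-∀

module Inequalities where

  open import Defs using (prodF)
  open import Data.Nat
  open import Data.Fin using (Fin)
  import Data.Fin as F
  open import Data.Nat.Properties
  open import Data.Product using (Σ; ∃; _×_; _,_)
  open import Data.Sum using (inj₁; inj₂)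
  open import Relation.Binary.PropositionalEquality
  open import Data.Nat.Tactic.RingSolver using (solve-∀)
  open import Algebra.Properties.CommutativeSemigroup *-commutativeSemigroup using (xy∙z≈x∙zy)

  ≤-by : ∀ {x y} z → y ≡ x + z → x ≤ y
  ≤-by {x} z e = subst (x ≤_) (sym e) (m≤m+n x z)

  ≤-split : ∀ {x y} → x ≤ y → ∃ λ d → y ≡ x + d
  ≤-split {x} {y} h = (y ∸ x) , sym (m+[n∸m]≡n h)

  -- Part (ii).  For one prime with L + P = E + q at two exponents, a smaller P'
  -- and Φ ≤ Q:  P'Q + L'Φ + EΦ ≤ PQ + LΦ + E'Φ  (the gap is (P - P')(Q - Φ)).
  ineq-ii : ∀ P P' L L' E E' q Q Φ → L + P ≡ E + q → L' + P' ≡ E' + q → P' ≤ P → Φ ≤ Q →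
    (P' * Q + L' * Φ) + E * Φ ≤ (P * Q + L * Φ) + E' * Φ
  ineq-ii P P' L L' E E' q Q Φ e e' P'≤P Φ≤Q with ≤-split P'≤P | ≤-split Φ≤Q
  ... | D , refl | K , refl = ≤-by (D * K) (begin
      (P' + D) * (Φ + K) + L * Φ + E' * Φ   ≡⟨ expand P' D Φ K L E' ⟩
      P' * (Φ + K) + D * K + (L + D + E') * Φ ≡⟨ cong (λ z → P' * (Φ + K) + D * K + z * Φ) balance ⟩
      P' * (Φ + K) + D * K + (L' + E) * Φ     ≡⟨ collect P' Φ K D L' E ⟩
      (P' * (Φ + K) + L' * Φ) + E * Φ + D * K ∎)
    where
    open ≡-Reasoning
    expand : ∀ P' D Φ K L E' → (P' + D) * (Φ + K) + L * Φ + E' * Φ ≡ P' * (Φ + K) + D * K + (L + D + E') * Φ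
    expand = solve-∀
    collect : ∀ P' Φ K D L' E → P' * (Φ + K) + D * K + (L' + E) * Φ ≡ (P' * (Φ + K) + L' * Φ) + E * Φ + D * K
    collect = solve-∀
    regroup₁ : ∀ L P' D E' q → (L + (P' + D)) + (E' + q) ≡ (L + D + E') + (P' + q)
    regroup₁ = solve-∀
    regroup₂ : ∀ E L' P' q → (E + q) + (L' + P') ≡ (L' + E) + (P' + q)
    regroup₂ = solve-∀
    balance : L + D + E' ≡ L' + E
    balance = +-cancelʳ-≡ (P' + q) _ _ (begin
      (L + D + E') + (P' + q)    ≡⟨ sym (regroup₁ L P' D E' q) ⟩
      (L + (P' + D)) + (E' + q)  ≡⟨ cong₂ _+_ e (sym e') ⟩
      (E + q) + (L' + P')        ≡⟨ regroup₂ E L' P' q ⟩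
      (L' + E) + (P' + q) ∎)

  ineq-iii : ∀ Pi₀ Pj₀ Piβ Pjβ Li₀ Lj₀ Liβ Ljβ Eiβ Ejβ Q Φ →
    Pi₀ * Pjβ ≤ Piβ * Pj₀ → Li₀ * Ljβ + Eiβ * Lj₀ ≤ Liβ * Lj₀ + Li₀ * Ejβ →
    (Pi₀ * (Pjβ * Q) + Li₀ * (Ljβ * Φ)) + Eiβ * (Lj₀ * Φ) ≤ (Piβ * (Pj₀ * Q) + Liβ * (Lj₀ * Φ)) + Li₀ * (Ejβ * Φ)
  ineq-iii Pi₀ Pj₀ Piβ Pjβ Li₀ Lj₀ Liβ Ljβ Eiβ Ejβ Q Φ hP hL = begin
      (Pi₀ * (Pjβ * Q) + Li₀ * (Ljβ * Φ)) + Eiβ * (Lj₀ * Φ) ≡⟨ factor₁ Pi₀ Pjβ Q Li₀ Ljβ Φ Eiβ Lj₀ ⟩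
      (Pi₀ * Pjβ) * Q + (Li₀ * Ljβ + Eiβ * Lj₀) * Φ       ≤⟨ +-mono-≤ (*-monoˡ-≤ Q hP) (*-monoˡ-≤ Φ hL) ⟩
      (Piβ * Pj₀) * Q + (Liβ * Lj₀ + Li₀ * Ejβ) * Φ       ≡⟨ factor₂ Piβ Pj₀ Q Liβ Lj₀ Φ Li₀ Ejβ ⟩
      (Piβ * (Pj₀ * Q) + Liβ * (Lj₀ * Φ)) + Li₀ * (Ejβ * Φ) ∎
    where
    open ≤-Reasoning
    factor₁ : ∀ a b Q c d Φ e f → (a * (b * Q) + c * (d * Φ)) + e * (f * Φ) ≡ (a * b) * Q + (c * d + e * f) * Φ
    factor₁ = solve-∀
    factor₂ : ∀ a b Q c d Φ e f → (a * b) * Q + (c * d + e * f) * Φ ≡ (a * (b * Q) + c * (d * Φ)) + e * (f * Φ)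
    factor₂ = solve-∀

  -- Part (iii), L/E-factors: with Lβ + Pβ = Eβ + qₓ and qₓ = Pβ + Dₓ at both
  -- primes, it suffices that φᵢ·Dⱼ ≤ Dᵢ·φⱼ (φ being the exponent-0 L-count).
  ineq-iii-L : ∀ qi qj Piβ Pjβ φi φj Liβ Ljβ Eiβ Ejβ Di Dj →
    Liβ + Piβ ≡ Eiβ + qi → Ljβ + Pjβ ≡ Ejβ + qj → qi ≡ Piβ + Di → qj ≡ Pjβ + Dj →
    φi * Dj ≤ Di * φj → φi * Ljβ + Eiβ * φj ≤ Liβ * φj + φi * Ejβ
  ineq-iii-L qi qj Piβ Pjβ φi φj Liβ Ljβ Eiβ Ejβ Di Dj ei ej refl refl h = begin
      φi * Ljβ + Eiβ * φj               ≡⟨ cong (λ z → φi * z + Eiβ * φj) (L≡E+D {Ljβ} {Pjβ} {Ejβ} {Dj} ej) ⟩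
      φi * (Ejβ + Dj) + Eiβ * φj        ≡⟨ split₁ φi Ejβ Dj Eiβ φj ⟩
      φi * Dj + (Eiβ * φj + φi * Ejβ)   ≤⟨ +-monoˡ-≤ _ h ⟩
      Di * φj + (Eiβ * φj + φi * Ejβ)   ≡⟨ split₂ Di φj Eiβ φi Ejβ ⟩
      (Eiβ + Di) * φj + φi * Ejβ        ≡⟨ cong (λ z → z * φj + φi * Ejβ) (sym (L≡E+D {Liβ} {Piβ} {Eiβ} {Di} ei)) ⟩
      Liβ * φj + φi * Ejβ ∎
    where
    open ≤-Reasoning
    split₁ : ∀ a b c d e → a * (b + c) + d * e ≡ a * c + (d * e + a * b)
    split₁ = solve-∀
    split₂ : ∀ a b c d e → a * b + (c * b + d * e) ≡ (c + a) * b + d * e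
    split₂ = solve-∀
    L≡E+D : ∀ {L P E D} → L + P ≡ E + (P + D) → L ≡ E + D
    L≡E+D {L} {P} {E} {D} e = +-cancelʳ-≡ P _ _ (trans e (shuffle E P D))
      where
      shuffle : ∀ E P D → E + (P + D) ≡ E + D + P
      shuffle = solve-∀

  geom : ℕ → ℕ → ℕ
  geom t zero = 0
  geom t (suc k) = t ^ k + geom t k

  geom-identity : ∀ t' k → geom (suc t') k * t' + 1 ≡ suc t' ^ k
  geom-identity t' zero = refl
  geom-identity t' (suc k) = begin
      (suc t' ^ k + geom (suc t') k) * t' + 1 ≡⟨ regroup (suc t' ^ k) (geom (suc t') k) t' ⟩
      suc t' ^ k * t' + (geom (suc t') k * t' + 1) ≡⟨ cong (suc t' ^ k * t' +_) (geom-identity t' k) ⟩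
      suc t' ^ k * t' + suc t' ^ k ≡⟨ collect (suc t' ^ k) t' ⟩
      suc t' * suc t' ^ k ∎
    where
    open ≡-Reasoning
    regroup : ∀ x g t → (x + g) * t + 1 ≡ x * t + (g * t + 1)
    regroup = solve-∀
    collect : ∀ x t → x * t + x ≡ suc t * x
    collect = solve-∀

  geom-shift : ∀ P d b → geom P (d + b) ≡ geom P d + P ^ d * geom P b
  geom-shift P d zero = trans (cong (geom P) (+-identityʳ d)) (sym (trans (cong (geom P d +_) (*-zeroʳ (P ^ d))) (+-identityʳ _)))
  geom-shift P d (suc b) = trans (cong (geom P) (+-suc d b))
    (trans (cong₂ _+_ (^-distribˡ-+-* P d b) (geom-shift P d b)) (collect (P ^ d) (P ^ b) (geom P d) (geom P b)))
    where
    collect : ∀ Pd Pb Gd Gb → Pd * Pb + (Gd + Pd * Gb) ≡ Gd + Pd * (Pb + Gb)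
    collect = solve-∀

  -- For p ≤ s:  p^k·(1 + s + … + s^k) ≤ s^k·(1 + p + … + p^k), termwise
  -- from p^k·s^t ≤ s^k·p^t for t ≤ k.
  geom-exchange : ∀ p s k → p ≤ s → geom s (suc k) * p ^ k ≤ geom p (suc k) * s ^ k
  geom-exchange p s zero h = ≤-refl
  geom-exchange p s (suc k) h = begin
      (s ^ suc k + geom s (suc k)) * p ^ suc k                  ≡⟨ regroup (s ^ suc k) (geom s (suc k)) p (p ^ k) ⟩
      s ^ suc k * p ^ suc k + (geom s (suc k) * p ^ k) * p      ≤⟨ +-monoʳ-≤ (s ^ suc k * p ^ suc k) (*-mono-≤ (geom-exchange p s k h) h) ⟩
      s ^ suc k * p ^ suc k + (geom p (suc k) * s ^ k) * s      ≡⟨ collect (p ^ suc k) (geom p (suc k)) s (s ^ k) ⟩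
      (p ^ suc k + geom p (suc k)) * s ^ suc k ∎
    where
    open ≤-Reasoning
    regroup : ∀ S G p pk → (S + G) * (p * pk) ≡ S * (p * pk) + (G * pk) * p
    regroup = solve-∀
    collect : ∀ P G s sk → (s * sk) * P + (G * sk) * s ≡ (P + G) * (s * sk)
    collect = solve-∀

  -- Part (iii), the core: φᵢDⱼ ≤ Dᵢφⱼ in the closed forms
  -- φ = p'·x·p^k, D = x·p'·geom p (k+1)  (x = p^(a-k-1), p' = p - 1).
  ineq-iii-core : ∀ P S k x y → 1 ≤ P → P ≤ S →
    (pred P * (x * P ^ k)) * (y * pred S * geom S (suc k)) ≤ (x * pred P * geom P (suc k)) * (pred S * (y * S ^ k))
  ineq-iii-core P@(suc p') S@(suc s') k x y _ h = begin
      (p' * (x * P ^ k)) * (y * s' * geom S (suc k))  ≡⟨ regroup₁ p' s' x y (P ^ k) (geom S (suc k)) ⟩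
      (x * y * p' * s') * (geom S (suc k) * P ^ k)    ≤⟨ *-monoʳ-≤ (x * y * p' * s') (geom-exchange P S k h) ⟩
      (x * y * p' * s') * (geom P (suc k) * S ^ k)    ≡⟨ regroup₂ p' s' x y (S ^ k) (geom P (suc k)) ⟩
      (x * p' * geom P (suc k)) * (s' * (y * S ^ k)) ∎
    where
    open ≤-Reasoning
    regroup₁ : ∀ p' s' x y pk Gs → (p' * (x * pk)) * (y * s' * Gs) ≡ (x * y * p' * s') * (Gs * pk)
    regroup₁ = solve-∀
    regroup₂ : ∀ p' s' x y sk Gp → (x * y * p' * s') * (Gp * sk) ≡ (x * p' * Gp) * (s' * (y * sk))
    regroup₂ = solve-∀

  ineq-iii-P : ∀ P S β x y → P ≤ S → (P ^ β * x) * y ≤ x * (S ^ β * y)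
  ineq-iii-P P S β x y h = begin
      (P ^ β * x) * y ≡⟨ regroup (P ^ β) x y ⟩
      x * (P ^ β * y) ≤⟨ *-monoʳ-≤ x (*-monoˡ-≤ y (^-monoˡ-≤ β h)) ⟩
      x * (S ^ β * y) ∎
    where
    open ≤-Reasoning
    regroup : ∀ Pb x y → (Pb * x) * y ≡ x * (Pb * y)
    regroup = solve-∀

  -- Throughout, P = p'+1 < S = s'+1, exponents a'+1 ≥ b'+1, and
  -- q = P^(a'+1), φ = p'·P^a' (resp. S) are the exponent-0 P- and L-counts.
  geom-exchange′ : ∀ p' s' a' b' → b' ≤ a' → suc p' ≤ suc s' →
    suc p' ^ a' * geom (suc s') (suc b') ≤ geom (suc p') (suc a') * suc s' ^ b'
  geom-exchange′ p' s' a' b' b≤a h = begin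
      P ^ a' * geom S (suc b')                    ≡⟨ cong (λ z → P ^ z * geom S (suc b')) (sym (m∸n+n≡m b≤a)) ⟩
      P ^ (d + b') * geom S (suc b')              ≡⟨ trans (cong (_* geom S (suc b')) (^-distribˡ-+-* P d b')) (xy∙z≈x∙zy (P ^ d) (P ^ b') _) ⟩
      P ^ d * (geom S (suc b') * P ^ b')          ≤⟨ *-monoʳ-≤ (P ^ d) (geom-exchange P S b' h) ⟩
      P ^ d * (geom P (suc b') * S ^ b')          ≡⟨ sym (*-assoc (P ^ d) _ _) ⟩
      (P ^ d * geom P (suc b')) * S ^ b'          ≤⟨ *-monoˡ-≤ (S ^ b') (m≤n+m _ (geom P d)) ⟩
      (geom P d + P ^ d * geom P (suc b')) * S ^ b' ≡⟨ cong (_* S ^ b') (sym (geom-shift P d (suc b'))) ⟩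
      geom P (d + suc b') * S ^ b'                ≡⟨ cong (λ z → geom P z * S ^ b') (trans (+-suc d b') (cong suc (m∸n+n≡m b≤a))) ⟩
      geom P (suc a') * S ^ b' ∎
    where
    open ≤-Reasoning
    P S d : ℕ
    P = suc p'
    S = suc s'
    d = a' ∸ b'

  ineq-i-L : ∀ p' s' a' b' → b' ≤ a' → suc p' ≤ suc s' →
    (p' * suc p' ^ a') * (suc s' ^ suc b') + s' * suc s' ^ b' ≤ (suc p' ^ suc a') * (s' * suc s' ^ b') + p' * suc p' ^ a'
  ineq-i-L p' s' a' b' b≤a h = begin
      (p' * tp) * (S ^ suc b') + s' * ts                         ≡⟨ cong (λ z → (p' * tp) * z + s' * ts) (sym (geom-identity s' (suc b'))) ⟩
      (p' * tp) * (geom S (suc b') * s' + 1) + s' * ts            ≡⟨ expand₁ p' s' tp ts (geom S (suc b')) ⟩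
      p' * s' * (tp * geom S (suc b')) + (p' * tp + s' * ts)      ≤⟨ +-monoˡ-≤ _ (*-monoʳ-≤ (p' * s') (geom-exchange′ p' s' a' b' b≤a h)) ⟩
      p' * s' * (geom P (suc a') * ts) + (p' * tp + s' * ts)      ≡⟨ sym (expand₂ p' s' tp ts (geom P (suc a'))) ⟩
      (geom P (suc a') * p' + 1) * (s' * ts) + p' * tp            ≡⟨ cong (λ z → z * (s' * ts) + p' * tp) (geom-identity p' (suc a')) ⟩
      (P ^ suc a') * (s' * ts) + p' * tp ∎
    where
    open ≤-Reasoning
    P S tp ts : ℕ
    P = suc p'
    S = suc s'
    tp = P ^ a'
    ts = S ^ b'
    expand₁ : ∀ p' s' tp ts G → (p' * tp) * (G * s' + 1) + s' * ts ≡ p' * s' * (tp * G) + (p' * tp + s' * ts)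
    expand₁ = solve-∀
    expand₂ : ∀ p' s' tp ts G → (G * p' + 1) * (s' * ts) + p' * tp ≡ p' * s' * (G * ts) + (p' * tp + s' * ts)
    expand₂ = solve-∀

  ineq-i-large : ∀ p' e τ D Q Φ tp → let p = suc p' ; s' = p + e ; s = suc s' ; ts = suc τ in
    p * tp ≡ s * ts + D → p * Q ≤ s' * Φ →
    (s * ts + D) * Q + (p' * tp * (s * ts) + s' * ts) * Φ ≤ (s * ts) * Q + ((s * ts + D) * (s' * ts) + p' * tp) * Φ
  ineq-i-large p' e τ D Q Φ tp eq hQ = *-cancelˡ-≤ (suc p') (begin
      p * ((s * ts + D) * Q + (p' * tp * (s * ts) + s' * ts) * Φ)                     ≡⟨ expand p' s' ts D Q Φ tp ⟩
      p * (s * ts) * Q + D * (p * Q) + (p' * (p * tp) * (s * ts) + p * s' * ts) * Φ    ≤⟨ +-monoˡ-≤ _ (+-monoʳ-≤ (p * (s * ts) * Q) (*-monoʳ-≤ D hQ)) ⟩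
      p * (s * ts) * Q + D * (s' * Φ) + (p' * (p * tp) * (s * ts) + p * s' * ts) * Φ ≡⟨ collect p' s' ts D Q Φ (p * tp) ⟩
      p * (s * ts) * Q + (D * s' + p' * (p * tp) * (s * ts) + p * s' * ts) * Φ        ≡⟨ cong (λ z → p * (s * ts) * Q + (D * s' + p' * z * (s * ts) + p * s' * ts) * Φ) eq ⟩
      p * (s * ts) * Q + (D * s' + p' * (s * ts + D) * (s * ts) + p * s' * ts) * Φ     ≤⟨ +-monoʳ-≤ (p * (s * ts) * Q) (*-monoˡ-≤ Φ bracket) ⟩
      p * (s * ts) * Q + (p * D * s' * ts + p * (s * ts) * s' * ts + p' * (s * ts + D)) * Φ
                                                       ≡⟨ cong (λ z → p * (s * ts) * Q + (p * D * s' * ts + p * (s * ts) * s' * ts + p' * z) * Φ) (sym eq) ⟩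
      p * (s * ts) * Q + (p * D * s' * ts + p * (s * ts) * s' * ts + p' * (p * tp)) * Φ ≡⟨ factor p' s' ts D Q Φ tp ⟩
      p * ((s * ts) * Q + ((s * ts + D) * (s' * ts) + p' * tp) * Φ) ∎)
    where
    open ≤-Reasoning
    p s' s ts : ℕ
    p = suc p'
    s' = p + e
    s = suc s'
    ts = suc τ
    gap : ∀ p' e τ D → let p = suc p' ; s' = p + e ; s = suc s' ; ts = suc τ in
      p * D * s' * ts + p * (s * ts) * s' * ts + p' * (s * ts + D)
      ≡ (D * s' + p' * (s * ts + D) * (s * ts) + p * s' * ts) + (1 + e) * ((s * ts + D) * τ + s' * ts)
    gap = solve-∀
    bracket : D * s' + p' * (s * ts + D) * (s * ts) + p * s' * ts ≤ p * D * s' * ts + p * (s * ts) * s' * ts + p' * (s * ts + D)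
    bracket = ≤-by _ (gap p' e τ D)
    expand : ∀ p' s' ts D Q Φ tp → suc p' * ((suc s' * ts + D) * Q + (p' * tp * (suc s' * ts) + s' * ts) * Φ)
         ≡ suc p' * (suc s' * ts) * Q + D * (suc p' * Q) + (p' * (suc p' * tp) * (suc s' * ts) + suc p' * s' * ts) * Φ
    expand = solve-∀
    collect : ∀ p' s' ts D Q Φ X → suc p' * (suc s' * ts) * Q + D * (s' * Φ) + (p' * X * (suc s' * ts) + suc p' * s' * ts) * Φ
         ≡ suc p' * (suc s' * ts) * Q + (D * s' + p' * X * (suc s' * ts) + suc p' * s' * ts) * Φ
    collect = solve-∀
    factor : ∀ p' s' ts D Q Φ tp → suc p' * (suc s' * ts) * Q + (suc p' * D * s' * ts + suc p' * (suc s' * ts) * s' * ts + p' * (suc p' * tp)) * Φ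
         ≡ suc p' * ((suc s' * ts) * Q + ((suc s' * ts + D) * (s' * ts) + p' * tp) * Φ)
    factor = solve-∀

  ineq-i-suc : ∀ p' s' a' b' Q Φ → b' ≤ a' → suc p' ≤ s' → suc p' * Q ≤ s' * Φ →
    let qp = suc p' ^ suc a' ; φp = p' * suc p' ^ a' ; qs = suc s' ^ suc b' ; φs = s' * suc s' ^ b' in
    qp * Q + (φp * qs + φs) * Φ ≤ qs * Q + (qp * φs + φp) * Φ
  ineq-i-suc p' s' a' b' Q Φ b≤a p<s hQ with ≤-total (suc p' ^ suc a') (suc s' ^ suc b')
  ... | inj₁ qp≤qs = +-mono-≤ (*-monoˡ-≤ Q qp≤qs) (*-monoˡ-≤ Φ (ineq-i-L p' s' a' b' b≤a (≤-trans p<s (n≤1+n s'))))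
  ... | inj₂ qs≤qp with ≤-split p<s
  ...   | e , refl = large (suc (suc p' + e) ^ b') (m^n>0 (suc (suc p' + e)) b') qs≤qp
    where
    σ s qp tp : ℕ
    σ = suc p' + e
    s = suc σ
    qp = suc p' ^ suc a'
    tp = suc p' ^ a'
    large : ∀ ts → 1 ≤ ts → s * ts ≤ qp →
      qp * Q + (p' * tp * (s * ts) + σ * ts) * Φ ≤ (s * ts) * Q + (qp * (σ * ts) + p' * tp) * Φ
    large (suc τ) _ le with ≤-split le
    ... | D , qp≡ = subst (λ z → z * Q + (p' * tp * (s * suc τ) + σ * suc τ) * Φ ≤ (s * suc τ) * Q + (z * (σ * suc τ) + p' * tp) * Φ)
                          (sym qp≡) (ineq-i-large p' e τ D Q Φ tp qp≡ hQ)

  Spread : ℕ → ℕ → ℕ → ℕ → Set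
  Spread p' P L E = Σ ℕ λ W → Σ ℕ λ V → P ≡ E + W × L ≡ P + p' * W + V

  spread-one : ∀ p' → Spread p' 1 1 1
  spread-one p' = 0 , 0 , refl , cong (λ z → 1 + z + 0) (sym (*-zeroʳ p'))

  spread-* : ∀ p' {P₁ L₁ E₁ P₂ L₂ E₂} → Spread p' P₁ L₁ E₁ → Spread p' P₂ L₂ E₂ → Spread p' (P₁ * P₂) (L₁ * L₂) (E₁ * E₂)
  spread-* p' {E₁ = E₁} {E₂ = E₂} (W₁ , V₁ , refl , refl) (W₂ , V₂ , refl , refl) =
    (E₁ * W₂ + W₁ * E₂ + W₁ * W₂) , (p' * W₁ * W₂ + (E₁ + W₁) * V₂ + V₁ * (E₂ + W₂) + (p' * W₁ + V₁) * (p' * W₂ + V₂)) ,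
    expandP E₁ W₁ E₂ W₂ , expandL p' E₁ W₁ V₁ E₂ W₂ V₂
    where
    expandP : ∀ E₁ W₁ E₂ W₂ → (E₁ + W₁) * (E₂ + W₂) ≡ E₁ * E₂ + (E₁ * W₂ + W₁ * E₂ + W₁ * W₂)
    expandP = solve-∀
    expandL : ∀ p' E₁ W₁ V₁ E₂ W₂ V₂ → ((E₁ + W₁) + p' * W₁ + V₁) * ((E₂ + W₂) + p' * W₂ + V₂)
          ≡ (E₁ + W₁) * (E₂ + W₂) + p' * (E₁ * W₂ + W₁ * E₂ + W₁ * W₂)
            + (p' * W₁ * W₂ + (E₁ + W₁) * V₂ + V₁ * (E₂ + W₂) + (p' * W₁ + V₁) * (p' * W₂ + V₂))
    expandL = solve-∀

  -- The quantity compared in part (iv): x·P' + y·L' + z·E' for a rest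
  -- (P', L', E') = (E + W, E + W + p'W + V) of spread p'.
  iv-form : (p' E W V x y z : ℕ) → ℕ
  iv-form p' E W V x y z = (x * (E + W) + y * ((E + W) + p' * W + V)) + z * E

  iv-form-cong : ∀ p' E W V {x y z x' y' z'} → x ≡ x' → y ≡ y' → z ≡ z' → iv-form p' E W V x y z ≡ iv-form p' E W V x' y' z'
  iv-form-cong p' E W V refl refl refl = refl

  spread-prodF : ∀ n p' (Pf Lf Ef : Fin n → ℕ) → (∀ j → Spread p' (Pf j) (Lf j) (Ef j)) →
    Spread p' (prodF n Pf) (prodF n Lf) (prodF n Ef)
  spread-prodF zero p' Pf Lf Ef h = spread-one p'
  spread-prodF (suc n) p' Pf Lf Ef h = spread-* p' (h F.zero) (spread-prodF n p' _ _ _ (λ j → h (F.suc j)))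

  -- Part (iv), first prime at its top exponent: with the exponent-0 counts
  -- P₀ = (p'+1)t, L₀ = E₀ = p't and the exponent-top counts 1, (p'+1)t, 1.
  ineq-iv-top : ∀ p' t E W V → iv-form p' E W V (suc p' * t) (p' * t) 1 ≤ iv-form p' E W V 1 (suc p' * t) (p' * t)
  ineq-iv-top p' t E W V = ≤-by (W + t * V) (gap p' t E W V)
    where
    gap : ∀ p' t E W V → (1 * (E + W) + (suc p' * t) * ((E + W) + p' * W + V)) + (p' * t) * E
                        ≡ (((suc p' * t) * (E + W) + (p' * t) * ((E + W) + p' * W + V)) + 1 * E) + (W + t * V)
    gap = solve-∀

  -- Part (iv), first prime below its top exponent (t = r + T, r = p^(a-c-1)).
  ineq-iv-below : ∀ p' r T E W V → iv-form p' E W V (suc p' * (r + T)) (p' * (r + T)) (p' * r)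
                                  ≤ iv-form p' E W V (suc p' * r) (p' * r + suc p' * T) (p' * (r + T))
  ineq-iv-below p' r T E W V = ≤-by (T * V) (gap p' r T E W V)
    where
    gap : ∀ p' r T E W V → ((suc p' * r) * (E + W) + (p' * r + suc p' * T) * ((E + W) + p' * W + V)) + (p' * (r + T)) * E
                        ≡ (((suc p' * (r + T)) * (E + W) + (p' * (r + T)) * ((E + W) + p' * W + V)) + (p' * r) * E) + T * V
    gap = solve-∀

  ineq-i : ∀ P S A B Q Φ → 1 ≤ P → P < S → 1 ≤ B → B ≤ A → P * Q ≤ pred S * Φ →
    let qp = P ^ A ; φp = pred P * P ^ pred A ; qs = S ^ B ; φs = pred S * S ^ pred B in
    qp * Q + (φp * qs + φs) * Φ ≤ qs * Q + (qp * φs + φp) * Φ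
  ineq-i (suc p') (suc s') (suc a') (suc b') Q Φ _ (s≤s p<s) _ (s≤s b≤a) hQ = ineq-i-suc p' s' a' b' Q Φ b≤a p<s hQ

  -- The middle primes of part (i): for p < t₀ < t₁ < … < t_{m-1} ≤ s',
  --   p·∏ t_k^(e_k+1) ≤ s'·∏ (t_k - 1)·t_k^e_k,
  -- telescoping p ≤ t₀ - 1, t₀ ≤ t₁ - 1, …, t_{m-1} ≤ s'.
  chain-bound : ∀ m (t e : Fin m → ℕ) (p s' : ℕ) → p ≤ s' → (∀ k → p < t k) → (∀ k → t k ≤ s') →
    (∀ k k' → k F.< k' → t k < t k') →
    p * prodF m (λ k → t k ^ suc (e k)) ≤ s' * prodF m (λ k → pred (t k) * t k ^ e k)
  chain-bound zero t e p s' h _ _ _ = *-monoˡ-≤ 1 h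
  chain-bound (suc m) t e p s' h p<t t≤s inc = begin
      p * (t₀ * t₀ ^ e₀ * Q)              ≡⟨ regroup₁ p t₀ (t₀ ^ e₀) Q ⟩
      (p * t₀ ^ e₀) * (t₀ * Q)            ≤⟨ *-mono-≤ (*-monoˡ-≤ (t₀ ^ e₀) (≤pred (p<t F.zero)))
                                                     (chain-bound m (λ k → t (F.suc k)) (λ k → e (F.suc k)) t₀ s' (t≤s F.zero)
                                                        (λ k → inc F.zero (F.suc k) z<s) (λ k → t≤s (F.suc k))
                                                        (λ k k' lt → inc (F.suc k) (F.suc k') (s<s lt))) ⟩
      (pred t₀ * t₀ ^ e₀) * (s' * Φ)      ≡⟨ regroup₂ (pred t₀ * t₀ ^ e₀) s' Φ ⟩
      s' * ((pred t₀ * t₀ ^ e₀) * Φ) ∎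
    where
    open ≤-Reasoning
    t₀ e₀ Q Φ : ℕ
    t₀ = t F.zero
    e₀ = e F.zero
    Q = prodF m (λ k → t (F.suc k) ^ suc (e (F.suc k)))
    Φ = prodF m (λ k → pred (t (F.suc k)) * t (F.suc k) ^ e (F.suc k))
    regroup₁ : ∀ p t te Q → p * (t * te * Q) ≡ (p * te) * (t * Q)
    regroup₁ = solve-∀
    regroup₂ : ∀ x s Φ → x * (s * Φ) ≡ s * (x * Φ)
    regroup₂ = solve-∀
    ≤pred : ∀ {x y} → x < y → x ≤ pred y
    ≤pred (s≤s h) = h

module LocalShapes where

  open import Data.Nat
  open import Data.Nat.Properties
  open import Data.Product using (_×_; _,_; proj₁; proj₂)
  open import Data.Sum using (inj₁; inj₂)
  open import Data.Empty using (⊥-elim)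
  open import Relation.Binary.PropositionalEquality
  open import Data.Nat.Tactic.RingSolver using (solve-∀)
  open LocalCounts
  open Inequalities
  open PrimePowers using (pow≥1)

  iii-shape : ∀ P A k → 1 ≤ P → suc k ≤ A → let x = P ^ (A ∸ suc k) in
    P ^ A ≡ locP P A (suc k) + x * pred P * geom P (suc k)
    × locL P A 0 ≡ pred P * (x * P ^ k)
    × locP P A 0 ≡ P ^ suc k * x
  iii-shape P@(suc p') A@(suc A') k _ (s≤s k≤A') = P^A , L₀ , P₀
    where
    x : ℕ
    x = P ^ (A' ∸ k)
    P^A : P ^ A ≡ locP P A (suc k) + x * p' * geom P (suc k)
    P^A = begin
      P ^ A                              ≡⟨ pow-split P (s≤s k≤A') ⟩
      P ^ suc k * x                      ≡⟨ cong (_* x) (sym (geom-identity p' (suc k))) ⟩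
      (geom P (suc k) * p' + 1) * x      ≡⟨ expand (geom P (suc k)) p' x ⟩
      x + x * p' * geom P (suc k)        ≡⟨ cong (_+ x * p' * geom P (suc k)) (sym (locP-value P A (suc k) (s≤s z≤n) (s≤s k≤A'))) ⟩
      locP P A (suc k) + x * p' * geom P (suc k) ∎
      where
      open ≡-Reasoning
      expand : ∀ G p' x → (G * p' + 1) * x ≡ x + x * p' * G
      expand = solve-∀
    L₀ : locL P A 0 ≡ p' * (x * P ^ k)
    L₀ = trans (locL-zero P A (s≤s z≤n) (s≤s z≤n)) (cong (p' *_) (trans (cong (P ^_) (sym (m∸n+n≡m k≤A'))) (^-distribˡ-+-* P (A' ∸ k) k)))
    P₀ : locP P A 0 ≡ P ^ suc k * x
    P₀ = trans (locP-value P A 0 (s≤s z≤n) z≤n) (pow-split P (s≤s k≤A'))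

  spread-local : ∀ S B c p' → suc (suc p') ≤ S → 1 ≤ c → c ≤ B → Spread p' (locP S B c) (locL S B c) (locE S B c)
  spread-local S B c p' S≥p'+2 c≥1 c≤B with m≤n⇒m<n∨m≡n c≤B | ≤-split S≥p'+2
  ... | inj₂ refl | _ = 0 , (S ^ c ∸ 1)
    , trans (locP-top S c S≥1) (sym (trans (+-identityʳ _) (locE-top S c S≥1)))
    , trans (locL-top S c) (trans (sym (m+[n∸m]≡n (pow≥1 S c S≥1)))
        (cong (λ z → z + (S ^ c ∸ 1)) (sym (trans (cong (λ w → w + p' * 0) (locP-top S c S≥1)) (cong suc (*-zeroʳ p'))))))
    where
    S≥1 : 1 ≤ S
    S≥1 = ≤-trans (s≤s z≤n) S≥p'+2
  ... | inj₁ c<B | e , refl = r , V , P≡E+r , L≡P+p'r+V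
    where
    s' S' r : ℕ
    s' = suc p' + e
    S' = suc s'
    r = S' ^ (B ∸ suc c)
    P≡E+r : locP S' B c ≡ locE S' B c + r
    P≡E+r = trans (locP-value S' B c (s≤s z≤n) c≤B) (sym (locE-below S' B c (s≤s z≤n) c<B))
    -- B ≥ (B - c - 1) + 2 since c ≥ 1, so S^B ≥ S²·r.
    B≥ : suc (suc (B ∸ suc c)) ≤ B
    B≥ = subst (suc (suc (B ∸ suc c)) ≤_) (m∸n+n≡m c<B) (subst (_≤ (B ∸ suc c) + suc c) (+-comm (B ∸ suc c) 2) (+-monoʳ-≤ (B ∸ suc c) (s≤s c≥1)))
    -- S^B = S·(S·r) + Δ
    Δ V : ℕ
    Δ = proj₁ (≤-split (^-monoʳ-≤ S' B≥))
    V = r * (1 + 2 * p' + 3 * e + p' * p' + 2 * p' * e + e * e) + Δ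
    L≡P+p'r+V : locL S' B c ≡ locP S' B c + p' * r + V
    L≡P+p'r+V = trans (+-cancelʳ-≡ r _ _ (trans (locL-below S' B c (s≤s z≤n) c<B) (trans (proj₂ (≤-split (^-monoʳ-≤ S' B≥))) (expand p' e r Δ))))
                      (cong (λ z → z + p' * r + V) (sym (locP-below s' B c c<B)))
      where
      expand : ∀ p' e r Δ → suc (suc p' + e) * (suc (suc p' + e) * r) + Δ
        ≡ (suc (suc p' + e) * r + p' * r + (r * (1 + 2 * p' + 3 * e + p' * p' + 2 * p' * e + e * e) + Δ)) + r
      expand = solve-∀

  iv-first : ∀ P A c → 1 ≤ P → 1 ≤ c → c ≤ A → ∀ E W V →
    iv-form (pred P) E W V (locP P A 0) (locL P A 0) (locE P A c) ≤ iv-form (pred P) E W V (locP P A c) (locL P A c) (locE P A 0)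
  iv-first (suc p') zero c _ c≥1 c≤0 E W V = ⊥-elim (<⇒≱ c≥1 c≤0)
  iv-first P@(suc p') A@(suc a') c _ c≥1 c≤A E W V =
    subst₂ _≤_ (sym (form-cong {z = locE P A c} P₀ L₀ refl)) (sym (form-cong {x = locP P A c} {y = locL P A c} refl refl E₀)) (at c≤A)
    where
    form-cong : ∀ {x y z x' y' z'} → x ≡ x' → y ≡ y' → z ≡ z' → iv-form p' E W V x y z ≡ iv-form p' E W V x' y' z'
    form-cong = iv-form-cong p' E W V
    t : ℕ
    t = P ^ a'
    P₀ : locP P A 0 ≡ P * t
    P₀ = locP-value P A 0 (s≤s z≤n) z≤n
    L₀ : locL P A 0 ≡ p' * t
    L₀ = locL-zero P A (s≤s z≤n) (s≤s z≤n)
    E₀ : locE P A 0 ≡ p' * t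
    E₀ = locE-zero P A (s≤s z≤n) (s≤s z≤n)
    at : ∀ {c} → c ≤ A → iv-form p' E W V (P * t) (p' * t) (locE P A c) ≤ iv-form p' E W V (locP P A c) (locL P A c) (p' * t)
    at {c} c≤A with m≤n⇒m<n∨m≡n c≤A
    ... | inj₂ refl = subst₂ _≤_ (sym (form-cong {x = P * t} {y = p' * t} refl refl (locE-top P A (s≤s z≤n))))
                                 (sym (form-cong {z = p' * t} (locP-top P A (s≤s z≤n)) (locL-top P A) refl))
                                 (ineq-iv-top p' t E W V)
    ... | inj₁ c<A = subst₂ _≤_ (sym (form-cong (cong (P *_) t≡) (cong (p' *_) t≡) (locE-below′ p' A c c<A)))
                                (sym (form-cong (locP-below p' A c c<A) Lc (cong (p' *_) t≡)))
                                (ineq-iv-below p' r T E W V)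
      where
      r T : ℕ
      r = P ^ (A ∸ suc c)
      T = proj₁ (≤-split (^-monoʳ-≤ P (m∸n≤m a' c)))
      t≡ : t ≡ r + T
      t≡ = proj₂ (≤-split (^-monoʳ-≤ P (m∸n≤m a' c)))
      Lc : locL P A c ≡ p' * r + P * T
      Lc = +-cancelʳ-≡ r _ _ (trans (locL-below P A c (s≤s z≤n) c<A) (trans (cong (P *_) t≡) (expand p' r T)))
        where
        expand : ∀ p' r T → suc p' * (r + T) ≡ p' * r + suc p' * T + r
        expand = solve-∀

module Comparisons (m : ℕ) (p a : Fin (suc (suc m)) → ℕ) (pr : ∀ i → Prime (p i))
                   (inc : ∀ i j → i F.< j → p i < p j) (a≥1 : ∀ i → 1 ≤ a i) where

  open import Data.Nat
  open import Data.Nat.Properties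
  open import Data.Fin using (punchIn)
  import Data.Fin.Properties as FP
  open import Data.Product using (_×_; _,_; proj₁; proj₂)
  open import Data.Sum using (inj₁; inj₂)
  open import Data.Empty using (⊥-elim)
  open import Relation.Binary.PropositionalEquality
  open import Relation.Binary.Definitions using (tri<; tri≈; tri>)
  open import Data.Nat.Tactic.RingSolver using (solve-∀)
  open PrimePowers using (Distinct; prime>1)
  open LocalCounts
  open Inequalities
  open LocalShapes
  open Products

  R : ℕ
  R = suc (suc m)

  distinct : Distinct R p
  distinct i j e with FP.<-cmp i j
  ... | tri< lt _ _ = ⊥-elim (<-irrefl e (inc i j lt))
  ... | tri≈ _ eq _ = eq
  ... | tri> _ _ gt = ⊥-elim (<-irrefl (sym e) (inc j i gt))

  open Criterion R p a pr distinct public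

  p≥1 : ∀ i → 1 ≤ p i
  p≥1 i = <⇒≤ (prime>1 (pr i))

  P L E : Fin R → ℕ → ℕ
  P i = locP (p i) (a i)
  L i = locL (p i) (a i)
  E i = locE (p i) (a i)

  L₀≡E₀ : ∀ i → L i 0 ≡ E i 0
  L₀≡E₀ i = locL≡locE-zero (p i) (a i) (p≥1 i) (a≥1 i)

  ≽-refl : ∀ c → c ≽ c
  ≽-refl c = ≤-refl

  part-ii : ∀ i γ β → γ < β → β ≤ a i → δ i γ ≽ δ i β
  part-ii i γ β γ<β β≤a = subst₂ _≤_ (sym (sides β γ)) (sym (sides γ β))
      (ineq-ii (P i γ) (P i β) (L i γ) (L i β) (E i γ) (E i β) (p i ^ a i) Q Φ
        (locL+locP (p i) (a i) γ (p≥1 i) γ≤a) (locL+locP (p i) (a i) β (p≥1 i) β≤a) Pβ≤Pγ Φ≤Q)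
    where
    γ≤a : γ ≤ a i
    γ≤a = ≤-trans (<⇒≤ γ<β) β≤a
    Q Φ : ℕ
    Q = prodF (suc m) (λ k → P (punchIn i k) 0)
    Φ = prodF (suc m) (λ k → L (punchIn i k) 0)
    Pβ≤Pγ : P i β ≤ P i γ
    Pβ≤Pγ = subst₂ _≤_ (sym (locP-value (p i) (a i) β (p≥1 i) β≤a)) (sym (locP-value (p i) (a i) γ (p≥1 i) γ≤a))
                       (^-monoʳ-≤ (p i) {{>-nonZero (p≥1 i)}} (∸-monoʳ-≤ (a i) (<⇒≤ γ<β)))
    Φ≤Q : Φ ≤ Q
    Φ≤Q = prodF-mono (suc m) (λ k → subst (_≤ P (punchIn i k) 0) (sym (L₀≡E₀ (punchIn i k)))
                                 (locE≤locP-zero (p (punchIn i k)) (a (punchIn i k)) (p≥1 _) (a≥1 _)))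
    sides : ∀ e e' → F (δ i e) + G (δ i e') ≡ (P i e * Q + L i e * Φ) + E i e' * Φ
    sides e e' = cong₂ _+_ (cong₂ _+_ (prodF-at-δ (suc m) P i e) (prodF-at-δ (suc m) L i e))
                           (trans (prodF-at-δ (suc m) E i e') (cong (E i e' *_) (prodF-ext (suc m) (λ k → sym (L₀≡E₀ (punchIn i k))))))

  module TwoPrimes (i : Fin R) (j' : Fin (suc m)) where

    j : Fin R
    j = punchIn i j'

    rest : Fin m → Fin R
    rest l = punchIn i (punchIn j' l)

    j≢i : j ≢ i
    j≢i = FP.punchInᵢ≢i i j'

    Q Φ : ℕ
    Q = prodF m (λ l → P (rest l) 0)
    Φ = prodF m (λ l → L (rest l) 0)

    split : ∀ (W : Fin R → ℕ → ℕ) (c : Fin R → ℕ) {eᵢ eⱼ} → c i ≡ eᵢ → c j ≡ eⱼ → (∀ l → c (rest l) ≡ 0) →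
      prodF R (λ l → W l (c l)) ≡ W i eᵢ * (W j eⱼ * prodF m (λ l → W (rest l) 0))
    split W c cᵢ cⱼ c-rest = trans (prodF-split₂ m (λ l → W l (c l)) i j')
      (cong₂ _*_ (cong (W i) cᵢ) (cong₂ _*_ (cong (W j) cⱼ) (prodF-ext m (λ l → cong (W (rest l)) (c-rest l)))))

    at-i : ∀ W e → prodF R (λ l → W l (δ i e l)) ≡ W i e * (W j 0 * prodF m (λ l → W (rest l) 0))
    at-i W e = split W (δ i e) (δ-self i e) (δ-other i j e j≢i) (λ l → δ-other i (rest l) e (FP.punchInᵢ≢i i _))

    at-j : ∀ W e → prodF R (λ l → W l (δ j e l)) ≡ W i 0 * (W j e * prodF m (λ l → W (rest l) 0))
    at-j W e = split W (δ j e) (δ-other j i e (λ eq → j≢i (sym eq))) (δ-self j e)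
      (λ l → δ-other j (rest l) e (λ eq → FP.punchInᵢ≢i j' l (FP.punchIn-injective i _ _ eq)))

    E-rest : prodF m (λ l → E (rest l) 0) ≡ Φ
    E-rest = prodF-ext m (λ l → sym (L₀≡E₀ (rest l)))

    side-j : ∀ eᵢ eⱼ → F (δ j eⱼ) + G (δ i eᵢ) ≡ (P i 0 * (P j eⱼ * Q) + L i 0 * (L j eⱼ * Φ)) + E i eᵢ * (L j 0 * Φ)
    side-j eᵢ eⱼ = cong₂ _+_ (cong₂ _+_ (at-j P eⱼ) (at-j L eⱼ)) (trans (at-i E eᵢ) (cong (E i eᵢ *_) (cong₂ _*_ (sym (L₀≡E₀ j)) E-rest)))

    side-i : ∀ eᵢ eⱼ → F (δ i eᵢ) + G (δ j eⱼ) ≡ (P i eᵢ * (P j 0 * Q) + L i eᵢ * (L j 0 * Φ)) + L i 0 * (E j eⱼ * Φ)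
    side-i eᵢ eⱼ = cong₂ _+_ (cong₂ _+_ (at-i P eᵢ) (at-i L eᵢ)) (trans (at-j E eⱼ) (cong₂ _*_ (sym (L₀≡E₀ i)) (cong (E j eⱼ *_) E-rest)))

  part-iii : ∀ i j' → i F.< punchIn i j' → ∀ k → suc k ≤ a i → suc k ≤ a (punchIn i j') →
    δ i (suc k) ≽ δ (punchIn i j') (suc k)
  part-iii i j' i<j k βi βj = subst₂ _≤_ (sym (side-j β β)) (sym (side-i β β))
      (ineq-iii (P i 0) (P j 0) (P i β) (P j β) (L i 0) (L j 0) (L i β) (L j β) (E i β) (E j β) Q Φ hP hL)
    where
    open TwoPrimes i j'
    β : ℕ
    β = suc k
    pᵢ≤pⱼ : p i ≤ p j
    pᵢ≤pⱼ = <⇒≤ (inc i j i<j)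
    x y : ℕ
    x = p i ^ (a i ∸ β)
    y = p j ^ (a j ∸ β)
    shapeᵢ : p i ^ a i ≡ P i β + x * pred (p i) * geom (p i) β × L i 0 ≡ pred (p i) * (x * p i ^ k) × P i 0 ≡ p i ^ β * x
    shapeᵢ = iii-shape (p i) (a i) k (p≥1 i) βi
    shapeⱼ : p j ^ a j ≡ P j β + y * pred (p j) * geom (p j) β × L j 0 ≡ pred (p j) * (y * p j ^ k) × P j 0 ≡ p j ^ β * y
    shapeⱼ = iii-shape (p j) (a j) k (p≥1 j) βj
    hP : P i 0 * P j β ≤ P i β * P j 0
    hP = subst₂ _≤_ (sym (cong₂ _*_ (proj₂ (proj₂ shapeᵢ)) (locP-value (p j) (a j) β (p≥1 j) βj)))
                    (sym (cong₂ _*_ (locP-value (p i) (a i) β (p≥1 i) βi) (proj₂ (proj₂ shapeⱼ))))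
                    (ineq-iii-P (p i) (p j) β x y pᵢ≤pⱼ)
    Dᵢ Dⱼ : ℕ
    Dᵢ = x * pred (p i) * geom (p i) β
    Dⱼ = y * pred (p j) * geom (p j) β
    hL : L i 0 * L j β + E i β * L j 0 ≤ L i β * L j 0 + L i 0 * E j β
    hL = ineq-iii-L (p i ^ a i) (p j ^ a j) (P i β) (P j β) (L i 0) (L j 0) (L i β) (L j β) (E i β) (E j β) Dᵢ Dⱼ
           (locL+locP (p i) (a i) β (p≥1 i) βi) (locL+locP (p j) (a j) β (p≥1 j) βj)
           (proj₁ shapeᵢ) (proj₁ shapeⱼ)
           (subst₂ (λ u v → u * Dⱼ ≤ Dᵢ * v) (sym (proj₁ (proj₂ shapeᵢ))) (sym (proj₁ (proj₂ shapeⱼ)))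
              (ineq-iii-core (p i) (p j) k x y (p≥1 i) pᵢ≤pⱼ))

  part-iii′ : ∀ i j → i F.< j → ∀ β → 1 ≤ β → β ≤ a i → β ≤ a j → δ i β ≽ δ j β
  part-iii′ i j i<j (suc k) _ βi βj =
    subst (λ j → δ i (suc k) ≽ δ j (suc k)) j≡
      (part-iii i j' (subst (i F.<_) (sym j≡) i<j) k βi (subst (λ j → suc k ≤ a j) (sym j≡) βj))
    where
    i≢j : i ≢ j
    i≢j = FP.<⇒≢ i<j
    j' : Fin (suc m)
    j' = F.punchOut i≢j
    j≡ : punchIn i j' ≡ j
    j≡ = FP.punchIn-punchOut i≢j

  drop-first : (Fin R → ℕ) → Fin R → ℕ
  drop-first β F.zero = 0
  drop-first β (F.suc j) = β (F.suc j)

  -- If all βᵢ ≥ 1 then ∏ pᵢ^βᵢ beats ∏_{i ≥ 1} pᵢ^βᵢ: the remaining primes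
  -- all exceed p₀, so their local counts have spread p₀ - 1.
  part-iv : ∀ β → (∀ i → 1 ≤ β i × β i ≤ a i) → β ≽ drop-first β
  part-iv β hβ = lower-first _ _ _ rest-spread
    where
    p' : ℕ
    p' = pred (p F.zero)
    rest-spread : Spread p' (prodF (suc m) (λ j → P (F.suc j) (β (F.suc j))))
                            (prodF (suc m) (λ j → L (F.suc j) (β (F.suc j))))
                            (prodF (suc m) (λ j → E (F.suc j) (β (F.suc j))))
    rest-spread = spread-prodF (suc m) p' _ _ _ (λ j → spread-local (p (F.suc j)) (a (F.suc j)) (β (F.suc j)) p'
      (subst (_< p (F.suc j)) (sym (suc-pred (p F.zero) {{>-nonZero (p≥1 F.zero)}})) (inc F.zero (F.suc j) z<s))
      (proj₁ (hβ (F.suc j))) (proj₂ (hβ (F.suc j))))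
    lower-first : ∀ P' L' E' → Spread p' P' L' E' →
      (P F.zero 0 * P' + L F.zero 0 * L') + E F.zero (β F.zero) * E' ≤ (P F.zero (β F.zero) * P' + L F.zero (β F.zero) * L') + E F.zero 0 * E'
    lower-first _ _ E' (W , V , refl , refl) =
      iv-first (p F.zero) (a F.zero) (β F.zero) (p≥1 F.zero) (proj₁ (hβ F.zero)) (proj₂ (hβ F.zero)) E' W V

  first last : Fin R → ℕ
  first = δ F.zero (a F.zero)
  last = δ (F.fromℕ (suc m)) (a (F.fromℕ (suc m)))

  module PartI where
    open TwoPrimes F.zero (F.fromℕ m)
    a₀ aₗ pₗ : ℕ
    a₀ = a F.zero
    aₗ = a j
    pₗ = p j

    rest-increasing : ∀ l l' → l F.< l' → p (rest l) < p (rest l')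
    rest-increasing l l' l<l' = inc (rest l) (rest l') (s<s (FP.≤∧≢⇒< (FP.punchIn-mono-≤ _ l l' (<⇒≤ l<l'))
                                                                  (λ e → FP.<⇒≢ l<l' (FP.punchIn-injective _ l l' e))))
    rest<last : ∀ l → p (rest l) < pₗ
    rest<last l = inc (rest l) j (s<s (FP.≤∧≢⇒< (FP.≤fromℕ _) (FP.punchInᵢ≢i (F.fromℕ m) l)))

    ≤pred : ∀ {u v} → u < v → u ≤ pred v
    ≤pred (s≤s h) = h

    middle : p F.zero * Q ≤ pred pₗ * Φ
    middle = subst₂ (λ u v → p F.zero * u ≤ pred pₗ * v)
      (prodF-ext m (λ l → trans (cong (p (rest l) ^_) (suc-pred (a (rest l)) {{>-nonZero (a≥1 (rest l))}}))
                                (sym (locP-value (p (rest l)) (a (rest l)) 0 (p≥1 (rest l)) z≤n))))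
      (prodF-ext m (λ l → sym (locL-zero (p (rest l)) (a (rest l)) (p≥1 (rest l)) (a≥1 (rest l)))))
      (chain-bound m (λ l → p (rest l)) (λ l → pred (a (rest l))) (p F.zero) (pred pₗ)
         (≤pred (inc F.zero j z<s)) (λ l → inc F.zero (rest l) z<s) (λ l → ≤pred (rest<last l)) (λ l l' → rest-increasing l l'))

    direct : aₗ ≤ a₀ → first ≽ last
    direct aₗ≤a₀ = subst₂ _≤_ (sym (trans (side-j a₀ aₗ) lhs)) (sym (trans (side-i a₀ aₗ) rhs))
      (ineq-i (p F.zero) pₗ a₀ aₗ Q Φ (p≥1 F.zero) (inc F.zero j z<s) (a≥1 j) aₗ≤a₀ middle)
      where
      qp φp qs φs : ℕ
      qp = p F.zero ^ a₀
      φp = pred (p F.zero) * p F.zero ^ pred a₀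
      qs = pₗ ^ aₗ
      φs = pred pₗ * pₗ ^ pred aₗ
      regroup₁ : ∀ qp Q φp Φ qs φs → (qp * (1 * Q) + φp * (qs * Φ)) + 1 * (φs * Φ) ≡ qp * Q + (φp * qs + φs) * Φ
      regroup₁ = solve-∀
      regroup₂ : ∀ qp Q φp Φ qs φs → (1 * (qs * Q) + qp * (φs * Φ)) + φp * (1 * Φ) ≡ qs * Q + (qp * φs + φp) * Φ
      regroup₂ = solve-∀
      lhs : (P F.zero 0 * (P j aₗ * Q) + L F.zero 0 * (L j aₗ * Φ)) + E F.zero a₀ * (L j 0 * Φ) ≡ qp * Q + (φp * qs + φs) * Φ
      lhs = trans (cong₂ _+_ (cong₂ _+_ (cong₂ (λ u v → u * (v * Q)) (locP-value (p F.zero) a₀ 0 (p≥1 F.zero) z≤n) (locP-top pₗ aₗ (p≥1 j)))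
                                          (cong₂ (λ u v → u * (v * Φ)) (locL-zero (p F.zero) a₀ (p≥1 F.zero) (a≥1 F.zero)) (locL-top pₗ aₗ)))
                             (cong₂ (λ u v → u * (v * Φ)) (locE-top (p F.zero) a₀ (p≥1 F.zero)) (locL-zero pₗ aₗ (p≥1 j) (a≥1 j))))
                  (regroup₁ qp Q φp Φ qs φs)
      rhs : (P F.zero a₀ * (P j 0 * Q) + L F.zero a₀ * (L j 0 * Φ)) + L F.zero 0 * (E j aₗ * Φ) ≡ qs * Q + (qp * φs + φp) * Φ
      rhs = trans (cong₂ _+_ (cong₂ _+_ (cong₂ (λ u v → u * (v * Q)) (locP-top (p F.zero) a₀ (p≥1 F.zero)) (locP-value pₗ aₗ 0 (p≥1 j) z≤n))
                                          (cong₂ (λ u v → u * (v * Φ)) (locL-top (p F.zero) a₀) (locL-zero pₗ aₗ (p≥1 j) (a≥1 j))))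
                             (cong₂ (λ u v → u * (v * Φ)) (locL-zero (p F.zero) a₀ (p≥1 F.zero) (a≥1 F.zero)) (locE-top pₗ aₗ (p≥1 j))))
                  (regroup₂ qp Q φp Φ qs φs)

    -- When a₀ ≤ a_last, go through p_last^a₀ using parts (iii) and (ii).
    via-last : a₀ ≤ aₗ → first ≽ last
    via-last a₀≤aₗ = ≽-trans first (δ j a₀) last (part-iii′ F.zero j z<s a₀ (a≥1 F.zero) ≤-refl a₀≤aₗ) lower
      where
      lower : δ j a₀ ≽ last
      lower with m≤n⇒m<n∨m≡n a₀≤aₗ
      ... | inj₁ a₀<aₗ = part-ii j a₀ aₗ a₀<aₗ ≤-refl
      ... | inj₂ a₀≡aₗ = subst (λ e → δ j a₀ ≽ δ j e) a₀≡aₗ (≽-refl (δ j a₀))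

  part-i : first ≽ last
  part-i with ≤-total (a F.zero) (a (F.fromℕ (suc m)))
  ... | inj₁ a₀≤aₗ = PartI.via-last a₀≤aₗ
  ... | inj₂ aₗ≤a₀ = PartI.direct aₗ≤a₀

  ≽⇒DegGe-δ : ∀ i j e e' → e ≤ a i → e' ≤ a j → δ i e ≽ δ j e' → DegGe n (p i ^ e) (p j ^ e')
  ≽⇒DegGe-δ i j e e' e≤a e'≤a c = subst₂ (DegGe n) (prodF-δ (suc m) p i e) (prodF-δ (suc m) p j e')
    (≽⇒DegGe (δ i e) (δ j e') (δ-≤ a i e e≤a) (δ-≤ a j e' e'≤a) c)

  drop-first-≤ : ∀ β → (∀ i → β i ≤ a i) → ∀ i → drop-first β i ≤ a i
  drop-first-≤ β h F.zero = z≤n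
  drop-first-≤ β h (F.suc j) = h (F.suc j)

-- Each part is the corresponding comparison of exponent vectors, turned into
-- a degree inequality by the criterion.
proposition4p5 : (m : ℕ) → (p α : Fin (suc (suc m)) → ℕ) →
    ((i : Fin (suc (suc m))) → Prime (p i)) →
    ((i j : Fin (suc (suc m))) → i F.< j → p i < p j) →
    ((i : Fin (suc (suc m))) → 1 ≤ α i) →
    (n : ℕ) → n ≡ prodF (suc (suc m)) (λ i → p i ^ α i) →
    DegGe n (p F.zero ^ α F.zero) (p (fromℕ (suc m)) ^ α (fromℕ (suc m)))
    × ((i : Fin (suc (suc m))) → (γ β : ℕ) → 1 ≤ γ → γ < β → β ≤ α i →
         DegGe n (p i ^ γ) (p i ^ β))
    × ((i j : Fin (suc (suc m))) → i F.< j → (β : ℕ) → 1 ≤ β → β ≤ α i → β ≤ α j →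
         DegGe n (p i ^ β) (p j ^ β))
    × ((β : Fin (suc (suc m)) → ℕ) →
         ((i : Fin (suc (suc m))) → 1 ≤ β i × β i ≤ α i) →
         sumF (suc (suc m)) β < sumF (suc (suc m)) α →
         DegGe n (prodF (suc (suc m)) (λ i → p i ^ β i))
                 (prodF (suc m) (λ i → p (F.suc i) ^ β (F.suc i))))
proposition4p5 m p α pr inc α≥1 n refl =
    ≽⇒DegGe-δ F.zero last′ (α F.zero) (α last′) ≤-refl ≤-refl part-i
  , (λ i γ β _ γ<β β≤α → ≽⇒DegGe-δ i i γ β (≤-trans (<⇒≤ γ<β) β≤α) β≤α (part-ii i γ β γ<β β≤α))
  , (λ i j i<j β β≥1 βᵢ βⱼ → ≽⇒DegGe-δ i j β β βᵢ βⱼ (part-iii′ i j i<j β β≥1 βᵢ βⱼ))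
  , (λ β hβ _ → subst (DegGe n (prodF (suc (suc m)) (λ i → p i ^ β i))) (*-identityˡ (prodF (suc m) (λ i → p (F.suc i) ^ β (F.suc i))))
       (≽⇒DegGe β (drop-first β) (λ i → proj₂ (hβ i)) (drop-first-≤ β (λ i → proj₂ (hβ i))) (part-iv β hβ)))
  where
  open Comparisons m p α pr inc α≥1 using (≽⇒DegGe; ≽⇒DegGe-δ; part-i; part-ii; part-iii′; part-iv; drop-first; drop-first-≤)
  open import Data.Nat.Properties using (≤-refl; ≤-trans; <⇒≤; *-identityˡ)
  open import Data.Product using (_,_; proj₂)
  open import Relation.Binary.PropositionalEquality using (subst)
  last′ : Fin (suc (suc m))
  last′ = fromℕ (suc m)
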